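{- Let $k_1,k_2$ be non-negative integers and $a_1,a_2$ odd integers such that $a_1a_2$ is a square modulo $4$. Then $(\mathbb CD_{2^{k_1}}(a_1)\otimes\mathbb CD_{2^{k_2}}(a_2))^{\Gamma_0(16)}=0$.
   Context: $e(x)=e^{2\pi ix}$. For $m\ge1$ and odd $a$, $D_m(a)$ is the discriminant form $\mathbb Z/2m\mathbb Z$ with $Q(\gamma)=a\gamma^2/(4m)$, $B(x,y)=Q(x+y)-Q(x)-Q(y)$, signature $\mathrm{sign}\in\mathbb Z/8\mathbb Z$ determined by $\sum_\gamma e(Q(\gamma))=\sqrt{2m}\,e(\mathrm{sign}/8)$. $\mathbb CD_m(a)$ has basis $\mathbf e^\gamma$ and carries the Weil representation of the metaplectic group $\mathrm{Mp}_2(\mathbb Z)$ (double cover of $\mathrm{SL}_2(\mathbb Z)$ generated by $T=(\begin{psmallmatrix}1&1\\0&1\end{psmallmatrix},1)$, $S=(\begin{psmallmatrix}0&-1\\1&0\end{psmallmatrix},\sqrt\tau)$): $\rho(T)\mathbf e^\gamma=e(Q(\gamma))\mathbf e^\gamma$, $\rho(S)\mathbf e^\gamma=\frac{e(-\mathrm{sign}/8)}{\sqrt{2m}}\sum_\beta e(-B(\gamma,\beta))\mathbf e^\beta$. The tensor product of two such representations has even total signature, so the action factors through $\mathrm{SL}_2(\mathbb Z)$; $V^\Gamma$ denotes the $\Gamma$-invariant vectors. -}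

module Defs where

open import Level using (Level; suc; _⊔_)
open import Algebra.Bundles using (CommutativeRing; Semiring)
import Algebra.Definitions.RawSemiring as RS
open import Data.Nat as ℕ using (ℕ; _∸_)
open import Data.Integer as ℤ using (ℤ; +_; -[1+_])
open import Data.Integer.Divisibility using () renaming (_∣_ to _∣ℤ_)
open import Data.Fin using (Fin; toℕ; _≟_)
open import Data.List using (List; []; _∷_)
open import Data.Product using (Σ; _×_; _,_)
open import Relation.Nullary using (¬_; yes; no)
open import Relation.Binary.PropositionalEquality using (_≡_)

record Char0Field (c ℓ : Level) : Set (suc (c ⊔ ℓ)) where
  field
    commutativeRing : CommutativeRing c ℓ
  open CommutativeRing commutativeRing public
  open RS (Semiring.rawSemiring semiring) public using (_^_; sum) renaming (_×_ to _·_)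
  field
    _⁻¹      : Carrier → Carrier
    ⁻¹-inv   : ∀ x → ¬ (x ≈ 0#) → (x * (x ⁻¹)) ≈ 1#
    nontrivial : ¬ (1# ≈ 0#)
    char0    : ∀ n → (n · 1#) ≈ 0# → n ≡ 0

Odd : ℤ → Set
Odd a = ¬ ((+ 2) ∣ℤ a)

-- Generators of the metaplectic group Mp₂(ℤ) used to form words:
-- S, T and T⁻¹ (these generate Mp₂(ℤ) as a monoid, since S has order 8).
data Gen : Set where
  S T T⁻ : Gen

Word : Set
Word = List Gen

record Mat2 : Set where
  constructor mat
  field a b c d : ℤ

_⊗M_ : Mat2 → Mat2 → Mat2
mat a b c d ⊗M mat a' b' c' d' =
  mat (a ℤ.* a' ℤ.+ b ℤ.* c') (a ℤ.* b' ℤ.+ b ℤ.* d')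
      (c ℤ.* a' ℤ.+ d ℤ.* c') (c ℤ.* b' ℤ.+ d ℤ.* d')

genMat : Gen → Mat2
genMat S  = mat (+ 0) (ℤ.- (+ 1)) (+ 1) (+ 0)
genMat T  = mat (+ 1) (+ 1) (+ 0) (+ 1)
genMat T⁻ = mat (+ 1) (ℤ.- (+ 1)) (+ 0) (+ 1)

wordMat : Word → Mat2
wordMat []      = mat (+ 1) (+ 0) (+ 0) (+ 1)
wordMat (g ∷ w) = genMat g ⊗M wordMat w

InΓ₀16 : Word → Set
InΓ₀16 w = (+ 16) ∣ℤ Mat2.c (wordMat w)

module Weil {c ℓ} (F : Char0Field c ℓ) (N : ℕ) (ζ : Char0Field.Carrier F) where
  open Char0Field F

  -- ζ is meant to be e(1/2^N)
  ζinv : Carrier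
  ζinv = ζ ^ (2 ℕ.^ N ∸ 1)

  -- e(z / 2^N)
  e : ℤ → Carrier
  e (+ n)      = ζ ^ n
  e -[1+ n ]   = ζinv ^ ℕ.suc n

  -- D_{2^k}(a): index set ℤ/2^{k+1}ℤ ≅ Fin (2^{k+1})
  size : ℕ → ℕ
  size k = 2 ℕ.^ ℕ.suc k

  -- e(Q(γ)) with Q(γ) = a γ² / 2^{k+2}, written as e(z/2^N)
  eQ : (k : ℕ) → ℤ → ℕ → Carrier
  eQ k a γ = e (a ℤ.* + (γ ℕ.* γ ℕ.* 2 ℕ.^ (N ∸ (k ℕ.+ 2))))

  eQneg : (k : ℕ) → ℤ → ℕ → Carrier
  eQneg k a γ = e (ℤ.- (a ℤ.* + (γ ℕ.* γ ℕ.* 2 ℕ.^ (N ∸ (k ℕ.+ 2)))))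

  -- e(-B(γ,β)) with B(γ,β) = a γ β / 2^{k+1}
  eBneg : (k : ℕ) → ℤ → ℕ → ℕ → Carrier
  eBneg k a γ β = e (ℤ.- (a ℤ.* + (γ ℕ.* β ℕ.* 2 ℕ.^ (N ∸ (k ℕ.+ 1)))))

  -- conj of the Gauss sum: Σ_δ e(-Q(δ)) = √(2m) e(-sign/8)
  gaussConj : (k : ℕ) → ℤ → Carrier
  gaussConj k a = sum (λ (δ : Fin (size k)) → eQneg k a (toℕ δ))

  -- matrix entries ρ(g)[β,γ] = coefficient of e^β in ρ(g) e^γ.
  -- ρ(S) uses  e(-sign/8)/√(2m) = conj(G)/(2m),  G = Σ_γ e(Q(γ)), |G|² = 2m.
  ρ : (k : ℕ) → ℤ → Gen → Fin (size k) → Fin (size k) → Carrier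
  ρ k a S β γ = (((size k) · 1#) ⁻¹) * (gaussConj k a * eBneg k a (toℕ γ) (toℕ β))
  ρ k a T β γ with β ≟ γ
  ... | yes _ = eQ k a (toℕ γ)
  ... | no  _ = 0#
  ρ k a T⁻ β γ with β ≟ γ
  ... | yes _ = eQneg k a (toℕ γ)
  ... | no  _ = 0#

  -- vectors of ℂD_{2^{k₁}}(a₁) ⊗ ℂD_{2^{k₂}}(a₂)  (coefficients of e^γ₁ ⊗ e^γ₂)
  TVec : ℕ → ℕ → Set c
  TVec k₁ k₂ = Fin (size k₁) → Fin (size k₂) → Carrier

  actGen : (k₁ k₂ : ℕ) (a₁ a₂ : ℤ) → Gen → TVec k₁ k₂ → TVec k₁ k₂
  actGen k₁ k₂ a₁ a₂ g v β₁ β₂ =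
    sum (λ γ₁ → sum (λ γ₂ → ρ k₁ a₁ g β₁ γ₁ * (ρ k₂ a₂ g β₂ γ₂ * v γ₁ γ₂)))

  act : (k₁ k₂ : ℕ) (a₁ a₂ : ℤ) → Word → TVec k₁ k₂ → TVec k₁ k₂
  act k₁ k₂ a₁ a₂ []      v = v
  act k₁ k₂ a₁ a₂ (g ∷ w) v = actGen k₁ k₂ a₁ a₂ g (act k₁ k₂ a₁ a₂ w v)

  Γ₀16-invariant : (k₁ k₂ : ℕ) (a₁ a₂ : ℤ) → TVec k₁ k₂ → Set ℓ
  Γ₀16-invariant k₁ k₂ a₁ a₂ v =
    ∀ (w : Word) → InΓ₀16 w → ∀ β₁ β₂ → act k₁ k₂ a₁ a₂ w v β₁ β₂ ≈ v β₁ β₂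

-- Let Q, B be the quadratic and bilinear forms of D = D_{2^k₁}(a₁) ⊕ D_{2^k₂}(a₂).  ρ(T) is
-- diagonal with eigenvalues e(Q(γ)), and ρ(S)² maps e^γ to e(−a₁/4)·e(−a₂/4)·e^{−γ}, the
-- scalar being the product of the squared normalised Gauss sums of the two factors.  As
-- a₁a₂ ≡ 1 (mod 4) forces a₁ + a₂ ≡ 2 (mod 4), that scalar is −1.  So a Γ₀(16)-invariant v
-- satisfies v(−γ) = −v(γ) and vanishes unless Q(γ) ∈ ℤ; and since ST¹⁶S³ ∈ Γ₀(16), the
-- vector u = ρ(S)v is fixed by ρ(T)¹⁶ and vanishes unless 16Q(β) ∈ ℤ.  For Q(γ) ∈ ℤ and
-- 16Q(β) ∈ ℤ, a Lagrange identity q(β)q(γ) = b(β,γ)² + a₁a₂2^(k₁+k₂)(γ₁β₂ − γ₂β₁)² for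
-- integral multiples q, b of Q, B, combined with the 2-adic anisotropy of x² + c·2ʲy²
-- when c ≡ 1 (mod 4), gives 2B(β,γ) ∈ ℤ; hence the rows γ and −γ of ρ(S) agree on the
-- support of u, and v(γ) = (ρ(S)u)(γ) = (ρ(S)u)(−γ) = v(−γ) = −v(γ).

module Submission where

open import Defs
open import Algebra.Bundles using (CommutativeSemiring)
open import Data.Nat as ℕ using (ℕ; zero; suc)
import Data.Nat.Properties as ℕ
open import Data.Nat.Tactic.RingSolver using () renaming (solve-∀ to ℕ-solve-∀)
open import Data.Integer as ℤ using (ℤ; +_)
import Data.Integer.Properties as ℤ
open import Data.Integer.Tactic.RingSolver using (solve-∀)
open import Data.Fin using (Fin; toℕ)
open import Data.Fin.Patterns using (0F; 1F; 2F; 3F; 4F; 5F)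
open import Data.Vec using ([]; _∷_)
open import Data.Product using (∃; ∃₂; _,_)
open import Data.Sum using (_⊎_; inj₁; inj₂)
open import Data.Empty using (⊥-elim)
open import Relation.Nullary using (¬_; yes; no; contradiction)
open import Relation.Binary.PropositionalEquality as ≡ using (_≡_; _≢_)

module Arithmetic where

  open import Data.Nat.Divisibility using (∣1⇒≡1)
  open import Data.Product using (_×_)
  open import Data.Integer using (_+_; _*_; -_; _-_)
  open import Data.Integer.DivMod using (_%ℕ_; _/ℕ_; a≡a%ℕn+[a/ℕn]*n; n%ℕd<d)
  import Data.Integer.Divisibility as Unsigned
  open import Data.Integer.Divisibility.Signed
    using (_∣_; divides; ∣⇒∣ᵤ; ∣ᵤ⇒∣; ∣-trans; ∣-refl; ∣m⇒∣m*n; ∣m+n∣m⇒∣n; ∣m∣n⇒∣m-n;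
           *-monoʳ-∣; *-monoˡ-∣; *-cancelˡ-∣)
  open ≡ using (refl; sym; trans; cong; cong₂; subst; subst₂; module ≡-Reasoning)

  pow₂ : ℕ → ℤ
  pow₂ k = + (2 ℕ.^ k)

  pow₂-suc : ∀ k → pow₂ (suc k) ≡ + 2 * pow₂ k
  pow₂-suc k = ℤ.pos-* 2 (2 ℕ.^ k)

  pow₂-+ : ∀ j k → pow₂ (j ℕ.+ k) ≡ pow₂ j * pow₂ k
  pow₂-+ j k = trans (cong +_ (ℕ.^-distribˡ-+-* 2 j k)) (ℤ.pos-* (2 ℕ.^ j) (2 ℕ.^ k))

  pow₂-2+ : ∀ j → pow₂ (suc (suc j)) ≡ + 4 * pow₂ j
  pow₂-2+ j = trans (pow₂-suc (suc j)) (trans (cong (+ 2 *_) (pow₂-suc j)) (sym (ℤ.*-assoc (+ 2) (+ 2) (pow₂ j))))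

  pow₂-double-suc : ∀ k → pow₂ (suc k ℕ.+ suc k) ≡ + 4 * pow₂ (k ℕ.+ k)
  pow₂-double-suc k = trans (cong (λ m → pow₂ (suc m)) (ℕ.+-suc k k)) (pow₂-2+ (k ℕ.+ k))

  parity : ∀ m → ∃ λ u → m ≡ + 2 * u ⊎ m ≡ + 2 * u + + 1
  parity m with m %ℕ 2 | n%ℕd<d m 2 | a≡a%ℕn+[a/ℕn]*n m 2
  ... | 0 | _ | eq = m /ℕ 2 , inj₁ (trans eq (trans (ℤ.+-identityˡ _) (ℤ.*-comm (m /ℕ 2) (+ 2))))
  ... | 1 | _ | eq = m /ℕ 2 , inj₂ (trans eq (trans (ℤ.+-comm (+ 1) (m /ℕ 2 * + 2)) (cong (_+ + 1) (ℤ.*-comm (m /ℕ 2) (+ 2)))))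
  ... | suc (suc _) | ℕ.s≤s (ℕ.s≤s ()) | _

  parityℕ : ∀ m → ∃ λ h → m ≡ 2 ℕ.* h ⊎ m ≡ suc (2 ℕ.* h)
  parityℕ zero = 0 , inj₁ refl
  parityℕ (suc m) with parityℕ m
  ... | h , inj₁ refl = h , inj₂ refl
  ... | h , inj₂ refl = suc h , inj₁ (sym (ℕ.*-suc 2 h))

  2ᵐ*2ⁿ≡2ᵐ⁺ⁿ : ∀ m n → 2 ℕ.^ m ℕ.* 2 ℕ.^ n ≡ 2 ℕ.^ (m ℕ.+ n)
  2ᵐ*2ⁿ≡2ᵐ⁺ⁿ m n = sym (ℕ.^-distribˡ-+-* 2 m n)

  2∤2*+1 : ∀ A → ¬ (+ 2 ∣ + 2 * A + + 1)
  2∤2*+1 A 2∣2A+1 with ∣1⇒≡1 (∣⇒∣ᵤ (∣m+n∣m⇒∣n 2∣2A+1 (∣m⇒∣m*n A ∣-refl)))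
  ... | ()

  4∤2*+1 : ∀ {n} A → n ≡ + 2 * A + + 1 → ¬ (+ 4 ∣ n)
  4∤2*+1 A refl 4∣n = 2∤2*+1 A (∣-trans (divides (+ 2) refl) 4∣n)

  4∤2*[2*+1] : ∀ {n} A → n ≡ + 2 * (+ 2 * A + + 1) → ¬ (+ 4 ∣ n)
  4∤2*[2*+1] A refl 4∣n = 2∤2*+1 A (*-cancelˡ-∣ (+ 2) 4∣n)

  Odd⇒≡2*+1 : ∀ {a} → Odd a → ∃ λ u → a ≡ + 2 * u + + 1
  Odd⇒≡2*+1 {a} odd with parity a
  ... | u , inj₂ a≡2u+1 = u , a≡2u+1
  ... | u , inj₁ refl = ⊥-elim (odd (∣⇒∣ᵤ (divides u (ℤ.*-comm (+ 2) u))))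

  norm : ℤ → ℕ → ℤ → ℤ → ℤ
  norm c j x y = x * x + c * pow₂ j * (y * y)

  module _ (w : ℤ) where

    private
      c : ℤ
      c = + 4 * w + + 1

    Descends : ℕ → ℤ → ℤ → Set
    Descends j x y = ∃₂ λ x′ y′ → ∃ λ j′ → x ≡ + 2 * x′ × norm c j x y ≡ + 4 * norm c j′ x′ y′

    private
      descent₀ : ∀ x y → + 4 ∣ norm c 0 x y → Descends 0 x y
      descent₀ x y 4∣n with parity x | parity y
      ... | z , inj₁ refl | e , inj₁ refl = z , e , 0 , refl , eq z e w
        where
        eq : ∀ z e w → + 2 * z * (+ 2 * z) + (+ 4 * w + + 1) * + 1 * (+ 2 * e * (+ 2 * e))
                       ≡ + 4 * (z * z + (+ 4 * w + + 1) * + 1 * (e * e))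
        eq = solve-∀
      ... | z , inj₁ refl | e , inj₂ refl = ⊥-elim (4∤2*+1 (+ 2 * (z * z + c * (e * e + e) + w)) (eq z e w) 4∣n)
        where
        eq : ∀ z e w → + 2 * z * (+ 2 * z) + (+ 4 * w + + 1) * + 1 * ((+ 2 * e + + 1) * (+ 2 * e + + 1))
                       ≡ + 2 * (+ 2 * (z * z + (+ 4 * w + + 1) * (e * e + e) + w)) + + 1
        eq = solve-∀
      ... | z , inj₂ refl | e , inj₁ refl = ⊥-elim (4∤2*+1 (+ 2 * (z * z + z + c * (e * e))) (eq z e w) 4∣n)
        where
        eq : ∀ z e w → (+ 2 * z + + 1) * (+ 2 * z + + 1) + (+ 4 * w + + 1) * + 1 * (+ 2 * e * (+ 2 * e))
                       ≡ + 2 * (+ 2 * (z * z + z + (+ 4 * w + + 1) * (e * e))) + + 1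
        eq = solve-∀
      ... | z , inj₂ refl | e , inj₂ refl = ⊥-elim (4∤2*[2*+1] (z * z + z + c * (e * e + e) + w) (eq z e w) 4∣n)
        where
        eq : ∀ z e w → (+ 2 * z + + 1) * (+ 2 * z + + 1) + (+ 4 * w + + 1) * + 1 * ((+ 2 * e + + 1) * (+ 2 * e + + 1))
                       ≡ + 2 * (+ 2 * (z * z + z + (+ 4 * w + + 1) * (e * e + e) + w) + + 1)
        eq = solve-∀

      descent₁ : ∀ x y → + 4 ∣ norm c 1 x y → Descends 1 x y
      descent₁ x y 4∣n with parity x | parity y
      ... | z , inj₁ refl | e , inj₁ refl = z , e , 1 , refl , eq z e w
        where
        eq : ∀ z e w → + 2 * z * (+ 2 * z) + (+ 4 * w + + 1) * + 2 * (+ 2 * e * (+ 2 * e))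
                       ≡ + 4 * (z * z + (+ 4 * w + + 1) * + 2 * (e * e))
        eq = solve-∀
      ... | z , inj₁ refl | e , inj₂ refl = ⊥-elim (4∤2*[2*+1] (z * z + + 2 * c * (e * e + e) + + 2 * w) (eq z e w) 4∣n)
        where
        eq : ∀ z e w → + 2 * z * (+ 2 * z) + (+ 4 * w + + 1) * + 2 * ((+ 2 * e + + 1) * (+ 2 * e + + 1))
                       ≡ + 2 * (+ 2 * (z * z + + 2 * (+ 4 * w + + 1) * (e * e + e) + + 2 * w) + + 1)
        eq = solve-∀
      ... | z , inj₂ refl | _ = ⊥-elim (4∤2*+1 (+ 2 * (z * z + z) + c * (y * y)) (eq z y w) 4∣n)
        where
        eq : ∀ z y w → (+ 2 * z + + 1) * (+ 2 * z + + 1) + (+ 4 * w + + 1) * + 2 * (y * y)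
                       ≡ + 2 * (+ 2 * (z * z + z) + (+ 4 * w + + 1) * (y * y)) + + 1
        eq = solve-∀

      descent₂₊ : ∀ j x y → + 4 ∣ norm c (2 ℕ.+ j) x y → Descends (2 ℕ.+ j) x y
      descent₂₊ j x y 4∣n with parity x
      ... | z , inj₁ refl =
        z , y , j , refl , trans (cong (λ p → + 2 * z * (+ 2 * z) + c * p * (y * y)) (pow₂-2+ j)) (eq z y (pow₂ j) w)
        where
        eq : ∀ z y p w → + 2 * z * (+ 2 * z) + (+ 4 * w + + 1) * (+ 4 * p) * (y * y)
                         ≡ + 4 * (z * z + (+ 4 * w + + 1) * p * (y * y))
        eq = solve-∀
      ... | z , inj₂ refl = ⊥-elim (4∤2*+1 (+ 2 * (z * z + z + c * pow₂ j * (y * y)))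
        (trans (cong (λ p → (+ 2 * z + + 1) * (+ 2 * z + + 1) + c * p * (y * y)) (pow₂-2+ j)) (eq z y (pow₂ j) w)) 4∣n)
        where
        eq : ∀ z y p w → (+ 2 * z + + 1) * (+ 2 * z + + 1) + (+ 4 * w + + 1) * (+ 4 * p) * (y * y)
                         ≡ + 2 * (+ 2 * (z * z + z + (+ 4 * w + + 1) * p * (y * y))) + + 1
        eq = solve-∀

    norm-descent : ∀ j x y → + 4 ∣ norm c j x y → Descends j x y
    norm-descent 0 = descent₀
    norm-descent 1 = descent₁
    norm-descent (suc (suc j)) = descent₂₊ j

    -- The 2-adic anisotropy of x² + c·2ʲ·y² for c ≡ 1 (mod 4), as an infinite descent.
    norm-anisotropic : ∀ K j x y → pow₂ (K ℕ.+ K) ∣ norm c j x y → pow₂ K ∣ x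
    norm-anisotropic zero j x y _ = divides x (sym (ℤ.*-identityʳ x))
    norm-anisotropic (suc K) j x y 4ᴷ⁺¹∣n
      with norm-descent j x y (∣-trans (divides (pow₂ (K ℕ.+ K)) (trans (pow₂-double-suc K) (ℤ.*-comm (+ 4) (pow₂ (K ℕ.+ K))))) 4ᴷ⁺¹∣n)
    ... | x′ , y′ , j′ , refl , n≡4n′ = subst (_∣ + 2 * x′) (sym (pow₂-suc K)) (*-monoʳ-∣ (+ 2) 2ᴷ∣x′)
      where
      2ᴷ∣x′ : pow₂ K ∣ x′
      2ᴷ∣x′ = norm-anisotropic K j′ x′ y′
        (*-cancelˡ-∣ (+ 4) (subst₂ _∣_ (pow₂-double-suc K) n≡4n′ 4ᴷ⁺¹∣n))

  odd-product-square⇒≡1[4] : ∀ {a₁ a₂} → Odd a₁ → Odd a₂ → (∃ λ x → + 4 Unsigned.∣ a₁ * a₂ - x * x) →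
                             ∃ λ w → a₁ * a₂ ≡ + 4 * w + + 1
  odd-product-square⇒≡1[4] {a₁} {a₂} odd₁ odd₂ (x , 4∣a₁a₂-x²)
    with Odd⇒≡2*+1 {a₁} odd₁ | Odd⇒≡2*+1 {a₂} odd₂ | ∣ᵤ⇒∣ {+ 4} {a₁ * a₂ - x * x} 4∣a₁a₂-x² | parity x
  ... | u₁ , refl | u₂ , refl | 4∣d | t , inj₁ refl =
    ⊥-elim (4∤2*+1 (+ 2 * u₁ * u₂ + u₁ + u₂ - + 2 * (t * t)) (eq u₁ u₂ t) 4∣d)
    where
    eq : ∀ u₁ u₂ t → (+ 2 * u₁ + + 1) * (+ 2 * u₂ + + 1) - + 2 * t * (+ 2 * t)
                     ≡ + 2 * (+ 2 * u₁ * u₂ + u₁ + u₂ - + 2 * (t * t)) + + 1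
    eq = solve-∀
  ... | _ | _ | divides q a₁a₂-x²≡4q | t , inj₂ refl = q + t * t + t , (begin
    a₁ * a₂                                           ≡⟨ split (a₁ * a₂) (x * x) ⟩
    (a₁ * a₂ - x * x) + x * x                         ≡⟨ cong (_+ x * x) a₁a₂-x²≡4q ⟩
    q * + 4 + (+ 2 * t + + 1) * (+ 2 * t + + 1)       ≡⟨ eq q t ⟩
    + 4 * (q + t * t + t) + + 1                       ∎)
    where
    open ≡-Reasoning
    split : ∀ m n → m ≡ (m - n) + n
    split = solve-∀
    eq : ∀ q t → q * + 4 + (+ 2 * t + + 1) * (+ 2 * t + + 1) ≡ + 4 * (q + t * t + t) + + 1
    eq = solve-∀

  odd-product≡1[4]⇒sum≡2[4] : ∀ {a₁ a₂ u₁ u₂ w} → a₁ ≡ + 2 * u₁ + + 1 → a₂ ≡ + 2 * u₂ + + 1 →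
                               a₁ * a₂ ≡ + 4 * w + + 1 → ∃ λ s → a₁ + a₂ ≡ + 2 * (+ 2 * s + + 1)
  odd-product≡1[4]⇒sum≡2[4] {u₁ = u₁} {u₂} {w} refl refl a₁a₂≡4w+1 = w - u₁ * u₂ , (begin
    (+ 2 * u₁ + + 1) + (+ 2 * u₂ + + 1) ≡⟨ sum-eq u₁ u₂ ⟩
    + 2 * ((u₁ + u₂) + + 1)             ≡⟨ cong (λ m → + 2 * (m + + 1)) u₁+u₂≡2s ⟩
    + 2 * (+ 2 * (w - u₁ * u₂) + + 1)   ∎)
    where
    open ≡-Reasoning
    sum-eq : ∀ u₁ u₂ → (+ 2 * u₁ + + 1) + (+ 2 * u₂ + + 1) ≡ + 2 * ((u₁ + u₂) + + 1)
    sum-eq = solve-∀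
    product-eq : ∀ u₁ u₂ → + 2 * (u₁ + u₂) ≡ (+ 2 * u₁ + + 1) * (+ 2 * u₂ + + 1) - + 4 * u₁ * u₂ - + 1
    product-eq = solve-∀
    rearrange : ∀ u₁ u₂ w → (+ 4 * w + + 1) - + 4 * u₁ * u₂ - + 1 ≡ + 2 * (+ 2 * (w - u₁ * u₂))
    rearrange = solve-∀
    u₁+u₂≡2s : u₁ + u₂ ≡ + 2 * (w - u₁ * u₂)
    u₁+u₂≡2s = ℤ.*-cancelˡ-≡ (+ 2) (u₁ + u₂) (+ 2 * (w - u₁ * u₂)) (begin
      + 2 * (u₁ + u₂)                                                ≡⟨ product-eq u₁ u₂ ⟩
      (+ 2 * u₁ + + 1) * (+ 2 * u₂ + + 1) - + 4 * u₁ * u₂ - + 1      ≡⟨ cong (λ m → m - + 4 * u₁ * u₂ - + 1) a₁a₂≡4w+1 ⟩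
      (+ 4 * w + + 1) - + 4 * u₁ * u₂ - + 1                          ≡⟨ rearrange u₁ u₂ w ⟩
      + 2 * (+ 2 * (w - u₁ * u₂))                                    ∎)

  -- q = 2^(K₁+K₂+2)·Q and b = 2^(K₁+K₂+1)·B for the quadratic form Q and bilinear form B
  -- of D_{2^K₁}(a₁) ⊕ D_{2^K₂}(a₂).
  module BinaryForm (a₁ a₂ : ℤ) (K₁ K₂ : ℕ) where

    P₁ P₂ : ℤ
    P₁ = pow₂ K₁
    P₂ = pow₂ K₂

    q : ℤ → ℤ → ℤ
    q x₁ x₂ = a₁ * (x₁ * x₁) * P₂ + a₂ * (x₂ * x₂) * P₁

    b : ℤ → ℤ → ℤ → ℤ → ℤ
    b x₁ x₂ y₁ y₂ = a₁ * (x₁ * y₁) * P₂ + a₂ * (x₂ * y₂) * P₁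

    lagrange : ∀ x₁ x₂ y₁ y₂ →
               q y₁ y₂ * q x₁ x₂ ≡ norm (a₁ * a₂) (K₁ ℕ.+ K₂) (b y₁ y₂ x₁ x₂) (x₁ * y₂ - x₂ * y₁)
    lagrange x₁ x₂ y₁ y₂ =
      trans (identity a₁ a₂ P₁ P₂ x₁ x₂ y₁ y₂)
            (cong (λ P → b y₁ y₂ x₁ x₂ * b y₁ y₂ x₁ x₂ + a₁ * a₂ * P * ((x₁ * y₂ - x₂ * y₁) * (x₁ * y₂ - x₂ * y₁)))
                  (sym (pow₂-+ K₁ K₂)))
      where
      identity : ∀ a₁ a₂ P₁ P₂ x₁ x₂ y₁ y₂ →
        (a₁ * (y₁ * y₁) * P₂ + a₂ * (y₂ * y₂) * P₁) * (a₁ * (x₁ * x₁) * P₂ + a₂ * (x₂ * x₂) * P₁)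
        ≡ (a₁ * (y₁ * x₁) * P₂ + a₂ * (y₂ * x₂) * P₁) * (a₁ * (y₁ * x₁) * P₂ + a₂ * (y₂ * x₂) * P₁)
          + a₁ * a₂ * (P₁ * P₂) * ((x₁ * y₂ - x₂ * y₁) * (x₁ * y₂ - x₂ * y₁))
      identity = solve-∀

    b-divisible : ∀ {w} → a₁ * a₂ ≡ + 4 * w + + 1 → ∀ {x₁ x₂ y₁ y₂} →
                  + 4 * (P₁ * P₂) ∣ q x₁ x₂ → P₁ * P₂ ∣ + 4 * q y₁ y₂ → P₁ * P₂ ∣ b y₁ y₂ x₁ x₂
    b-divisible {w} a₁a₂≡4w+1 {x₁} {x₂} {y₁} {y₂} 4P∣qx P∣4qy =
      subst (_∣ b y₁ y₂ x₁ x₂) (pow₂-+ K₁ K₂) (norm-anisotropic w K K (b y₁ y₂ x₁ x₂) (x₁ * y₂ - x₂ * y₁) 4ᴷ∣norm)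
      where
      K = K₁ ℕ.+ K₂
      P = P₁ * P₂
      B = b y₁ y₂ x₁ x₂
      D = x₁ * y₂ - x₂ * y₁
      P[4P]∣4qyqx : P * (+ 4 * P) ∣ + 4 * q y₁ y₂ * q x₁ x₂
      P[4P]∣4qyqx = ∣-trans (*-monoˡ-∣ (+ 4 * P) P∣4qy) (*-monoʳ-∣ (+ 4 * q y₁ y₂) 4P∣qx)
      P[4P]≡4·4ᴷ : P * (+ 4 * P) ≡ + 4 * pow₂ (K ℕ.+ K)
      P[4P]≡4·4ᴷ = begin
        P * (+ 4 * P)                ≡⟨ swap P P ⟩
        + 4 * (P * P)                ≡⟨ cong (λ p → + 4 * (p * p)) (sym (pow₂-+ K₁ K₂)) ⟩
        + 4 * (pow₂ K * pow₂ K)      ≡⟨ cong (+ 4 *_) (sym (pow₂-+ K K)) ⟩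
        + 4 * pow₂ (K ℕ.+ K)         ∎
        where
        open ≡-Reasoning
        swap : ∀ m n → m * (+ 4 * n) ≡ + 4 * (m * n)
        swap = solve-∀
      4qyqx≡4·norm : + 4 * q y₁ y₂ * q x₁ x₂ ≡ + 4 * norm (+ 4 * w + + 1) K B D
      4qyqx≡4·norm = begin
        + 4 * q y₁ y₂ * q x₁ x₂           ≡⟨ ℤ.*-assoc (+ 4) (q y₁ y₂) (q x₁ x₂) ⟩
        + 4 * (q y₁ y₂ * q x₁ x₂)         ≡⟨ cong (+ 4 *_) (lagrange x₁ x₂ y₁ y₂) ⟩
        + 4 * norm (a₁ * a₂) K B D        ≡⟨ cong (λ c → + 4 * norm c K B D) a₁a₂≡4w+1 ⟩
        + 4 * norm (+ 4 * w + + 1) K B D  ∎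
        where open ≡-Reasoning
      4ᴷ∣norm : pow₂ (K ℕ.+ K) ∣ norm (+ 4 * w + + 1) K B D
      4ᴷ∣norm = *-cancelˡ-∣ (+ 4) (subst₂ _∣_ P[4P]≡4·4ᴷ 4qyqx≡4·norm P[4P]∣4qyqx)

    b-antipodal : ∀ y₁ y₂ {g₁ g₂ h₁ h₂} → + 2 * P₁ ∣ g₁ + h₁ → + 2 * P₂ ∣ g₂ + h₂ →
                  + 2 * (P₁ * P₂) ∣ b y₁ y₂ g₁ g₂ + b y₁ y₂ h₁ h₂
    b-antipodal y₁ y₂ {g₁} {g₂} {h₁} {h₂} (divides s₁ g₁+h₁≡) (divides s₂ g₂+h₂≡) =
      divides (a₁ * y₁ * s₁ + a₂ * y₂ * s₂) (begin
        b y₁ y₂ g₁ g₂ + b y₁ y₂ h₁ h₂                           ≡⟨ additive a₁ a₂ P₁ P₂ y₁ y₂ g₁ g₂ h₁ h₂ ⟩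
        a₁ * (y₁ * (g₁ + h₁)) * P₂ + a₂ * (y₂ * (g₂ + h₂)) * P₁
          ≡⟨ cong₂ (λ m n → a₁ * (y₁ * m) * P₂ + a₂ * (y₂ * n) * P₁) g₁+h₁≡ g₂+h₂≡ ⟩
        a₁ * (y₁ * (s₁ * (+ 2 * P₁))) * P₂ + a₂ * (y₂ * (s₂ * (+ 2 * P₂))) * P₁ ≡⟨ factor a₁ a₂ P₁ P₂ y₁ y₂ s₁ s₂ ⟩
        (a₁ * y₁ * s₁ + a₂ * y₂ * s₂) * (+ 2 * (P₁ * P₂))       ∎)
      where
      open ≡-Reasoning
      additive : ∀ a₁ a₂ P₁ P₂ y₁ y₂ g₁ g₂ h₁ h₂ →
        (a₁ * (y₁ * g₁) * P₂ + a₂ * (y₂ * g₂) * P₁) + (a₁ * (y₁ * h₁) * P₂ + a₂ * (y₂ * h₂) * P₁)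
        ≡ a₁ * (y₁ * (g₁ + h₁)) * P₂ + a₂ * (y₂ * (g₂ + h₂)) * P₁
      additive = solve-∀
      factor : ∀ a₁ a₂ P₁ P₂ y₁ y₂ s₁ s₂ →
        a₁ * (y₁ * (s₁ * (+ 2 * P₁))) * P₂ + a₂ * (y₂ * (s₂ * (+ 2 * P₂))) * P₁
        ≡ (a₁ * y₁ * s₁ + a₂ * y₂ * s₂) * (+ 2 * (P₁ * P₂))
      factor = solve-∀

    4b-antipodal-invariant : ∀ {w} → a₁ * a₂ ≡ + 4 * w + + 1 → ∀ {y₁ y₂ g₁ g₂ h₁ h₂} →
      + 4 * (P₁ * P₂) ∣ q g₁ g₂ → P₁ * P₂ ∣ + 4 * q y₁ y₂ → + 2 * P₁ ∣ g₁ + h₁ → + 2 * P₂ ∣ g₂ + h₂ →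
      + 8 * (P₁ * P₂) ∣ + 4 * b y₁ y₂ g₁ g₂ - + 4 * b y₁ y₂ h₁ h₂
    4b-antipodal-invariant {w} a₁a₂≡4w+1 {y₁} {y₂} {g₁} {g₂} {h₁} {h₂} 4P∣qg P∣4qy 2P₁∣g₁+h₁ 2P₂∣g₂+h₂ =
      subst (+ 8 * (P₁ * P₂) ∣_) (rearrange (b y₁ y₂ g₁ g₂) (b y₁ y₂ h₁ h₂))
            (∣m∣n⇒∣m-n (*-monoʳ-∣ (+ 8) (b-divisible {w} a₁a₂≡4w+1 {g₁} {g₂} {y₁} {y₂} 4P∣qg P∣4qy))
                       (subst (_∣ + 4 * (b y₁ y₂ g₁ g₂ + b y₁ y₂ h₁ h₂)) (sym (ℤ.*-assoc (+ 4) (+ 2) (P₁ * P₂)))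
                              (*-monoʳ-∣ (+ 4) (b-antipodal y₁ y₂ 2P₁∣g₁+h₁ 2P₂∣g₂+h₂))))
      where
      rearrange : ∀ m n → + 8 * m - + 4 * (m + n) ≡ + 4 * m - + 4 * n
      rearrange = solve-∀

module Antipode where

  open import Data.Nat using (_<_; _≤_; s≤s)
  open import Data.Nat.Divisibility using (_∣_; divides; ∣-refl; ∣m+n∣m⇒∣n; ∣⇒≤)
  open import Data.Fin using (fromℕ<) renaming (suc to sucF)
  import Data.Fin.Properties as Fin
  open ≡ using (refl; sym; trans; cong; subst; module ≡-Reasoning)

  ∣∧<⇒≡0 : ∀ {n m} → n ∣ m → m < n → m ≡ 0
  ∣∧<⇒≡0 {m = zero} _ _ = refl
  ∣∧<⇒≡0 {m = suc m} n∣m m<n = contradiction (∣⇒≤ n∣m) (ℕ.<⇒≱ m<n)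

  private
    ∣+-cancel-≤ : ∀ {n b d d′} → n ∣ b ℕ.+ d → n ∣ b ℕ.+ d′ → d ≤ d′ → d′ < n → d ≡ d′
    ∣+-cancel-≤ {n} {b} {d} {d′} n∣b+d n∣b+d′ d≤d′ d′<n = begin
      d                    ≡⟨ sym (ℕ.+-identityʳ d) ⟩
      d ℕ.+ 0              ≡⟨ cong (d ℕ.+_) (sym (∣∧<⇒≡0 n∣gap gap<n)) ⟩
      d ℕ.+ (d′ ℕ.∸ d)     ≡⟨ ℕ.m+[n∸m]≡n d≤d′ ⟩
      d′                   ∎
      where
      open ≡-Reasoning
      n∣gap : n ∣ d′ ℕ.∸ d
      n∣gap = ∣m+n∣m⇒∣n (subst (n ∣_) (trans (cong (b ℕ.+_) (sym (ℕ.m+[n∸m]≡n d≤d′))) (sym (ℕ.+-assoc b d _))) n∣b+d′) n∣b+d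
      gap<n : d′ ℕ.∸ d < n
      gap<n = ℕ.≤-<-trans (ℕ.m∸n≤m d′ d) d′<n

  ∣+-cancel-< : ∀ {n b d d′} → n ∣ b ℕ.+ d → n ∣ b ℕ.+ d′ → d < n → d′ < n → d ≡ d′
  ∣+-cancel-< {d = d} {d′} n∣b+d n∣b+d′ d<n d′<n with ℕ.≤-total d d′
  ... | inj₁ d≤d′ = ∣+-cancel-≤ n∣b+d n∣b+d′ d≤d′ d′<n
  ... | inj₂ d′≤d = sym (∣+-cancel-≤ n∣b+d′ n∣b+d d′≤d d<n)

  antipode : ∀ {n} → Fin n → Fin n
  antipode 0F = 0F
  antipode {suc n} (sucF β) = fromℕ< (s≤s (ℕ.m∸n≤m n (toℕ β)))

  antipode-∣ : ∀ {n} (β : Fin n) → n ∣ toℕ β ℕ.+ toℕ (antipode β)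
  antipode-∣ {suc n} 0F = divides 0 refl
  antipode-∣ {suc n} (sucF β) =
    subst (suc n ∣_) (sym (cong suc (trans (cong (toℕ β ℕ.+_) (Fin.toℕ-fromℕ< _)) (ℕ.m+[n∸m]≡n (ℕ.<⇒≤ (Fin.toℕ<n β)))))) ∣-refl

  antipode-unique : ∀ {n} {β δ : Fin n} → n ∣ toℕ β ℕ.+ toℕ δ → δ ≡ antipode β
  antipode-unique {β = β} {δ} n∣β+δ = Fin.toℕ-injective (∣+-cancel-< n∣β+δ (antipode-∣ β) (Fin.toℕ<n δ) (Fin.toℕ<n (antipode β)))

  antipode-involutive : ∀ {n} (β : Fin n) → antipode (antipode β) ≡ β
  antipode-involutive {n} β = sym (antipode-unique (subst (n ∣_) (ℕ.+-comm (toℕ β) _) (antipode-∣ β)))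

module Sums {c ℓ} (R : CommutativeSemiring c ℓ) where

  open import Data.Fin using (zero; suc)
  open import Data.Fin.Properties using (suc-injective)
  open CommutativeSemiring R hiding (zero)
  open import Algebra.Properties.Semiring.Sum semiring
    using (sum; sum-cong-≋; ∑-comm; sum-replicate; sum-replicate-zero; *-distribˡ-sum; ∑-distrib-+)
  open import Algebra.Properties.Monoid.Mult +-monoid using (_×_)
  open import Relation.Binary.Reasoning.Setoid setoid

  sum-δ : ∀ {n} (β : Fin n) (f : Fin n → Carrier) → (∀ γ → γ ≢ β → f γ ≈ 0#) → sum f ≈ f β
  sum-δ {ℕ.suc n} zero f f≈0 = begin
    f zero + sum (λ γ → f (suc γ)) ≈⟨ +-congˡ (trans (sum-cong-≋ (λ γ → f≈0 (suc γ) λ ())) (sum-replicate-zero n)) ⟩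
    f zero + 0#                    ≈⟨ +-identityʳ _ ⟩
    f zero                         ∎
  sum-δ {ℕ.suc n} (suc β) f f≈0 = begin
    f zero + sum (λ γ → f (suc γ)) ≈⟨ +-cong (f≈0 zero λ ()) (sum-δ β (λ γ → f (suc γ)) tail≈0) ⟩
    0# + f (suc β)                 ≈⟨ +-identityˡ _ ⟩
    f (suc β)                      ∎
    where
    tail≈0 : ∀ γ → γ ≢ β → f (suc γ) ≈ 0#
    tail≈0 γ γ≢β = f≈0 (suc γ) λ sγ≡sβ → γ≢β (suc-injective sγ≡sβ)

  ∑²-comm : ∀ {m n} (t : Fin m → Fin n → Fin m → Fin n → Carrier) →
            (sum λ γ₁ → sum λ γ₂ → sum λ δ₁ → sum λ δ₂ → t γ₁ γ₂ δ₁ δ₂)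
            ≈ (sum λ δ₁ → sum λ δ₂ → sum λ γ₁ → sum λ γ₂ → t γ₁ γ₂ δ₁ δ₂)
  ∑²-comm t = begin
    (sum λ γ₁ → sum λ γ₂ → sum λ δ₁ → sum λ δ₂ → t γ₁ γ₂ δ₁ δ₂)
      ≈⟨ sum-cong-≋ (λ γ₁ → ∑-comm λ γ₂ δ₁ → sum λ δ₂ → t γ₁ γ₂ δ₁ δ₂) ⟩
    (sum λ γ₁ → sum λ δ₁ → sum λ γ₂ → sum λ δ₂ → t γ₁ γ₂ δ₁ δ₂)
      ≈⟨ ∑-comm (λ γ₁ δ₁ → sum λ γ₂ → sum λ δ₂ → t γ₁ γ₂ δ₁ δ₂) ⟩
    (sum λ δ₁ → sum λ γ₁ → sum λ γ₂ → sum λ δ₂ → t γ₁ γ₂ δ₁ δ₂)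
      ≈⟨ sum-cong-≋ (λ δ₁ → sum-cong-≋ λ γ₁ → ∑-comm λ γ₂ δ₂ → t γ₁ γ₂ δ₁ δ₂) ⟩
    (sum λ δ₁ → sum λ γ₁ → sum λ δ₂ → sum λ γ₂ → t γ₁ γ₂ δ₁ δ₂)
      ≈⟨ sum-cong-≋ (λ δ₁ → ∑-comm λ γ₁ δ₂ → sum λ γ₂ → t γ₁ γ₂ δ₁ δ₂) ⟩
    (sum λ δ₁ → sum λ δ₂ → sum λ γ₁ → sum λ γ₂ → t γ₁ γ₂ δ₁ δ₂) ∎

  sumℕ : ℕ → (ℕ → Carrier) → Carrier
  sumℕ n f = sum {n} λ i → f (toℕ i)

  sumℕ-cong : ∀ n {f g : ℕ → Carrier} → (∀ i → f i ≈ g i) → sumℕ n f ≈ sumℕ n g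
  sumℕ-cong n {f} {g} f≈g = sum-cong-≋ {n} {λ i → f (toℕ i)} {λ i → g (toℕ i)} λ i → f≈g (toℕ i)

  sumℕ-const : ∀ n x → sumℕ n (λ _ → x) ≈ n × x
  sumℕ-const n x = sum-replicate n

  sumℕ-*ˡ : ∀ n x f → x * sumℕ n f ≈ sumℕ n (λ i → x * f i)
  sumℕ-*ˡ n x f = *-distribˡ-sum {n} x (λ i → f (toℕ i))

  sumℕ-distrib : ∀ n f g → sumℕ n (λ i → f i + g i) ≈ sumℕ n f + sumℕ n g
  sumℕ-distrib n f g = ∑-distrib-+ {n} (λ i → f (toℕ i)) (λ i → g (toℕ i))

  sumℕ-+ : ∀ m n f → sumℕ (m ℕ.+ n) f ≈ sumℕ m f + sumℕ n (λ i → f (m ℕ.+ i))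
  sumℕ-+ zero n f = sym (+-identityˡ _)
  sumℕ-+ (suc m) n f = trans (+-congˡ (sumℕ-+ m n (λ i → f (suc i)))) (sym (+-assoc _ _ _))

  sumℕ-halves : ∀ n f → sumℕ (2 ℕ.* n) f ≈ sumℕ n f + sumℕ n (λ i → f (n ℕ.+ i))
  sumℕ-halves n f = trans (sumℕ-+ n (n ℕ.+ 0) f) (+-congˡ (reflexive (≡.cong (λ m → sumℕ m (λ i → f (n ℕ.+ i))) (ℕ.+-identityʳ n))))

  sumℕ-pairs : ∀ n f → sumℕ (2 ℕ.* n) f ≈ sumℕ n (λ i → f (2 ℕ.* i) + f (suc (2 ℕ.* i)))
  sumℕ-pairs zero f = refl
  sumℕ-pairs (suc n) f = begin
    sumℕ (2 ℕ.* suc n) f                                  ≡⟨ ≡.cong (λ m → sumℕ m f) (ℕ.*-suc 2 n) ⟩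
    f 0 + (f 1 + sumℕ (2 ℕ.* n) (λ i → f (2 ℕ.+ i)))      ≈⟨ +-assoc (f 0) (f 1) _ ⟨
    (f 0 + f 1) + sumℕ (2 ℕ.* n) (λ i → f (2 ℕ.+ i))      ≈⟨ +-congˡ (sumℕ-pairs n (λ i → f (2 ℕ.+ i))) ⟩
    (f 0 + f 1) + sumℕ n (λ i → f (2 ℕ.+ 2 ℕ.* i) + f (3 ℕ.+ 2 ℕ.* i))
      ≈⟨ +-congˡ (sumℕ-cong n λ i → reflexive (≡.cong (λ m → f m + f (suc m)) (≡.sym (ℕ.*-suc 2 i)))) ⟩
    sumℕ (suc n) (λ i → f (2 ℕ.* i) + f (suc (2 ℕ.* i)))  ∎

module TensorAction {c ℓ} (R : CommutativeSemiring c ℓ) where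

  open CommutativeSemiring R hiding (zero)
  open import Algebra.Properties.Semiring.Sum semiring
    using (sum; sum-cong-≋; *-distribˡ-sum; *-distribʳ-sum; sum-replicate-zero)
  open import Algebra.Solver.CommutativeMonoid *-commutativeMonoid using (prove; var; _⊕_)
  open import Relation.Binary.Reasoning.Setoid setoid
  open Sums R using (sum-δ; ∑²-comm)

  Matrix : ℕ → Set c
  Matrix n = Fin n → Fin n → Carrier

  _∙_ : ∀ {n} → Matrix n → Matrix n → Matrix n
  (A ∙ B) β δ = sum λ γ → A β γ * B γ δ

  Tensor : ℕ → ℕ → Set c
  Tensor m n = Fin m → Fin n → Carrier

  _≋_ : ∀ {m n} → Tensor m n → Tensor m n → Set ℓ
  v ≋ w = ∀ β₁ β₂ → v β₁ β₂ ≈ w β₁ β₂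

  _⊗_ : ∀ {m n} → Matrix m → Matrix n → Tensor m n → Tensor m n
  (A ⊗ B) v β₁ β₂ = sum λ γ₁ → sum λ γ₂ → A β₁ γ₁ * (B β₂ γ₂ * v γ₁ γ₂)
  ⊗-cong : ∀ {m n} (A : Matrix m) (B : Matrix n) {v w} → v ≋ w → (A ⊗ B) v ≋ (A ⊗ B) w
  ⊗-cong A B v≋w β₁ β₂ = sum-cong-≋ λ γ₁ → sum-cong-≋ λ γ₂ → *-congˡ (*-congˡ (v≋w γ₁ γ₂))

  ⊗-monomial : ∀ {m n} {A : Matrix m} {B : Matrix n} (π₁ : Fin m → Fin m) (π₂ : Fin n → Fin n) →
               (∀ β γ → γ ≢ π₁ β → A β γ ≈ 0#) → (∀ β γ → γ ≢ π₂ β → B β γ ≈ 0#) →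
               ∀ v β₁ β₂ → (A ⊗ B) v β₁ β₂ ≈ A β₁ (π₁ β₁) * (B β₂ (π₂ β₂) * v (π₁ β₁) (π₂ β₂))
  ⊗-monomial {n = n} {A} {B} π₁ π₂ A-off B-off v β₁ β₂ = begin
    (A ⊗ B) v β₁ β₂                                       ≈⟨ sum-δ (π₁ β₁) _ outer-off ⟩
    sum (λ γ₂ → A β₁ (π₁ β₁) * (B β₂ γ₂ * v (π₁ β₁) γ₂))  ≈⟨ sum-δ (π₂ β₂) _ inner-off ⟩
    A β₁ (π₁ β₁) * (B β₂ (π₂ β₂) * v (π₁ β₁) (π₂ β₂))     ∎
    where
    outer-off : ∀ γ₁ → γ₁ ≢ π₁ β₁ → (sum λ γ₂ → A β₁ γ₁ * (B β₂ γ₂ * v γ₁ γ₂)) ≈ 0#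
    outer-off γ₁ γ₁≢ = trans (sum-cong-≋ λ γ₂ → trans (*-congʳ (A-off β₁ γ₁ γ₁≢)) (zeroˡ (B β₂ γ₂ * v γ₁ γ₂)))
                             (sum-replicate-zero n)
    inner-off : ∀ γ₂ → γ₂ ≢ π₂ β₂ → A β₁ (π₁ β₁) * (B β₂ γ₂ * v (π₁ β₁) γ₂) ≈ 0#
    inner-off γ₂ γ₂≢ = trans (*-congˡ (trans (*-congʳ (B-off β₂ γ₂ γ₂≢)) (zeroˡ (v (π₁ β₁) γ₂)))) (zeroʳ (A β₁ (π₁ β₁)))

  ⊗-∙ : ∀ {m n} (A₁ B₁ : Matrix m) (A₂ B₂ : Matrix n) v →
        (A₁ ⊗ A₂) ((B₁ ⊗ B₂) v) ≋ ((A₁ ∙ B₁) ⊗ (A₂ ∙ B₂)) v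
  ⊗-∙ A₁ B₁ A₂ B₂ v β₁ β₂ = begin
    (sum λ γ₁ → sum λ γ₂ → A₁ β₁ γ₁ * (A₂ β₂ γ₂ * sum λ δ₁ → sum λ δ₂ → B₁ γ₁ δ₁ * (B₂ γ₂ δ₂ * v δ₁ δ₂)))
      ≈⟨ sum-cong-≋ (λ γ₁ → sum-cong-≋ λ γ₂ → expand γ₁ γ₂) ⟩
    (sum λ γ₁ → sum λ γ₂ → sum λ δ₁ → sum λ δ₂ → t γ₁ γ₂ δ₁ δ₂)
      ≈⟨ ∑²-comm t ⟩
    (sum λ δ₁ → sum λ δ₂ → sum λ γ₁ → sum λ γ₂ → t γ₁ γ₂ δ₁ δ₂)
      ≈⟨ sum-cong-≋ (λ δ₁ → sum-cong-≋ λ δ₂ → factor δ₁ δ₂) ⟩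
    ((A₁ ∙ B₁) ⊗ (A₂ ∙ B₂)) v β₁ β₂ ∎
    where
    t : _ → _ → _ → _ → Carrier
    t γ₁ γ₂ δ₁ δ₂ = (A₁ β₁ γ₁ * B₁ γ₁ δ₁) * ((A₂ β₂ γ₂ * B₂ γ₂ δ₂) * v δ₁ δ₂)
    expand : ∀ γ₁ γ₂ → A₁ β₁ γ₁ * (A₂ β₂ γ₂ * sum λ δ₁ → sum λ δ₂ → B₁ γ₁ δ₁ * (B₂ γ₂ δ₂ * v δ₁ δ₂))
                     ≈ sum λ δ₁ → sum λ δ₂ → t γ₁ γ₂ δ₁ δ₂
    expand γ₁ γ₂ = begin
      a₁ * (a₂ * sum λ δ₁ → sum λ δ₂ → B₁ γ₁ δ₁ * (B₂ γ₂ δ₂ * v δ₁ δ₂))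
        ≈⟨ *-congˡ (trans (*-distribˡ-sum a₂ (λ δ₁ → sum λ δ₂ → b δ₁ δ₂)) (sum-cong-≋ λ δ₁ → *-distribˡ-sum a₂ (b δ₁))) ⟩
      a₁ * (sum λ δ₁ → sum λ δ₂ → a₂ * (B₁ γ₁ δ₁ * (B₂ γ₂ δ₂ * v δ₁ δ₂)))
        ≈⟨ trans (*-distribˡ-sum a₁ (λ δ₁ → sum λ δ₂ → a₂ * b δ₁ δ₂))
                 (sum-cong-≋ λ δ₁ → *-distribˡ-sum a₁ λ δ₂ → a₂ * b δ₁ δ₂) ⟩
      (sum λ δ₁ → sum λ δ₂ → a₁ * (a₂ * (B₁ γ₁ δ₁ * (B₂ γ₂ δ₂ * v δ₁ δ₂))))
        ≈⟨ sum-cong-≋ (λ δ₁ → sum-cong-≋ λ δ₂ →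
             prove 5 (var 0F ⊕ (var 1F ⊕ (var 2F ⊕ (var 3F ⊕ var 4F))))
                     ((var 0F ⊕ var 2F) ⊕ ((var 1F ⊕ var 3F) ⊕ var 4F))
                     (a₁ ∷ a₂ ∷ B₁ γ₁ δ₁ ∷ B₂ γ₂ δ₂ ∷ v δ₁ δ₂ ∷ [])) ⟩
      (sum λ δ₁ → sum λ δ₂ → t γ₁ γ₂ δ₁ δ₂) ∎
      where
      a₁ = A₁ β₁ γ₁
      a₂ = A₂ β₂ γ₂
      b : _ → _ → Carrier
      b δ₁ δ₂ = B₁ γ₁ δ₁ * (B₂ γ₂ δ₂ * v δ₁ δ₂)
    factor : ∀ δ₁ δ₂ → (sum λ γ₁ → sum λ γ₂ → t γ₁ γ₂ δ₁ δ₂) ≈ (A₁ ∙ B₁) β₁ δ₁ * ((A₂ ∙ B₂) β₂ δ₂ * v δ₁ δ₂)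
    factor δ₁ δ₂ = begin
      (sum λ γ₁ → sum λ γ₂ → t γ₁ γ₂ δ₁ δ₂)
        ≈⟨ sum-cong-≋ (λ γ₁ → sym (*-distribˡ-sum (A₁ β₁ γ₁ * B₁ γ₁ δ₁) λ γ₂ → (A₂ β₂ γ₂ * B₂ γ₂ δ₂) * v δ₁ δ₂)) ⟩
      (sum λ γ₁ → (A₁ β₁ γ₁ * B₁ γ₁ δ₁) * sum λ γ₂ → (A₂ β₂ γ₂ * B₂ γ₂ δ₂) * v δ₁ δ₂)
        ≈⟨ sym (*-distribʳ-sum (sum λ γ₂ → (A₂ β₂ γ₂ * B₂ γ₂ δ₂) * v δ₁ δ₂) λ γ₁ → A₁ β₁ γ₁ * B₁ γ₁ δ₁) ⟩
      (A₁ ∙ B₁) β₁ δ₁ * (sum λ γ₂ → (A₂ β₂ γ₂ * B₂ γ₂ δ₂) * v δ₁ δ₂)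
        ≈⟨ *-congˡ (sym (*-distribʳ-sum (v δ₁ δ₂) λ γ₂ → A₂ β₂ γ₂ * B₂ γ₂ δ₂)) ⟩
      (A₁ ∙ B₁) β₁ δ₁ * ((A₂ ∙ B₂) β₂ δ₂ * v δ₁ δ₂) ∎

module FieldFacts {c ℓ} (F : Char0Field c ℓ) where

  open Char0Field F hiding (zero)
  open import Algebra.Properties.Ring ring using (-‿distribˡ-*; x∙y⁻¹≈ε⇒x≈y; -‿involutive)
  open import Relation.Binary.Reasoning.Setoid setoid

  *-cancelˡ-≉0 : ∀ {x y} → ¬ x ≈ 0# → x * y ≈ 0# → y ≈ 0#
  *-cancelˡ-≉0 {x} {y} x≉0 xy≈0 = begin
    y                  ≈⟨ *-identityˡ y ⟨
    1# * y             ≈⟨ *-congʳ (trans (*-comm (x ⁻¹) x) (⁻¹-inv x x≉0)) ⟨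
    ((x ⁻¹) * x) * y   ≈⟨ *-assoc (x ⁻¹) x y ⟩
    (x ⁻¹) * (x * y)   ≈⟨ *-congˡ xy≈0 ⟩
    (x ⁻¹) * 0#        ≈⟨ zeroʳ (x ⁻¹) ⟩
    0#                 ∎

  suc·1≉0 : ∀ n → ¬ (suc n · 1# ≈ 0#)
  suc·1≉0 n eq with char0 (suc n) eq
  ... | ()

  x≈-x⇒x≈0 : ∀ {x} → x ≈ - x → x ≈ 0#
  x≈-x⇒x≈0 {x} x≈-x = *-cancelˡ-≉0 (suc·1≉0 1) (begin
    (1# + (1# + 0#)) * x   ≈⟨ *-congʳ (+-congˡ (+-identityʳ 1#)) ⟩
    (1# + 1#) * x          ≈⟨ distribʳ x 1# 1# ⟩
    1# * x + 1# * x        ≈⟨ +-cong (*-identityˡ x) (trans (*-identityˡ x) x≈-x) ⟩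
    x - x                  ≈⟨ -‿inverseʳ x ⟩
    0#                     ∎)

  -1≉1 : ¬ (- 1# ≈ 1#)
  -1≉1 -1≈1 = nontrivial (x≈-x⇒x≈0 (sym -1≈1))

  -1*-1≈1 : - 1# * - 1# ≈ 1#
  -1*-1≈1 = trans (sym (-‿distribˡ-* 1# (- 1#))) (trans (-‿cong (*-identityˡ (- 1#))) (-‿involutive 1#))

  1^n≈1 : ∀ n → 1# ^ n ≈ 1#
  1^n≈1 zero = refl
  1^n≈1 (suc n) = trans (*-identityˡ _) (1^n≈1 n)

  ≉1-fixed⇒≈0 : ∀ {t y} → ¬ t ≈ 1# → t * y ≈ y → y ≈ 0#
  ≉1-fixed⇒≈0 {t} {y} t≉1 ty≈y = *-cancelˡ-≉0 (λ t-1≈0 → t≉1 (x∙y⁻¹≈ε⇒x≈y t 1# t-1≈0)) (begin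
    (t - 1#) * y        ≈⟨ distribʳ y t (- 1#) ⟩
    t * y + - 1# * y    ≈⟨ +-cong ty≈y (trans (sym (-‿distribˡ-* 1# y)) (-‿cong (*-identityˡ y))) ⟩
    y - y               ≈⟨ -‿inverseʳ y ⟩
    0#                  ∎)

  2·x≈x+x : ∀ x → 2 · x ≈ x + x
  2·x≈x+x x = +-congˡ (+-identityʳ x)

  [x+x]²≈2·2·x² : ∀ x → (x + x) * (x + x) ≈ 2 · (2 · (x * x))
  [x+x]²≈2·2·x² x = begin
    (x + x) * (x + x)                      ≈⟨ distribʳ (x + x) x x ⟩
    x * (x + x) + x * (x + x)              ≈⟨ +-cong (distribˡ x x x) (distribˡ x x x) ⟩
    (x * x + x * x) + (x * x + x * x)      ≈⟨ +-cong (2·x≈x+x (x * x)) (2·x≈x+x (x * x)) ⟨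
    2 · (x * x) + 2 · (x * x)              ≈⟨ 2·x≈x+x (2 · (x * x)) ⟨
    2 · (2 · (x * x))                      ∎

module Character {c ℓ} (F : Char0Field c ℓ) (L : ℕ) (ζ : Char0Field.Carrier F)
                 (ζ-half : Char0Field._≈_ F (Char0Field._^_ F ζ (2 ℕ.^ suc L)) (Char0Field.-_ F (Char0Field.1# F))) where

  open import Data.Nat.Divisibility using (1∣_; divides) renaming (_∣_ to _∣ℕ_; _∣?_ to _∣ℕ?_; *-monoʳ-∣ to *-monoʳ-∣ℕ)
  open import Data.Integer using (-[1+_]; _⊖_)
  open import Data.Integer.Divisibility.Signed using (_∣_; divides; *-monoʳ-∣)
  open import Data.Fin using (_≟_)

  open Char0Field F hiding (zero)
  open import Algebra.Properties.Ring ring using (-1*x≈-x)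
  open import Algebra.Properties.Semiring.Exp semiring using (^-homo-*; ^-assocʳ; ^-congˡ)
  open import Algebra.Properties.Semiring.Mult semiring using (×-assoc-*)
  open import Algebra.Properties.Semiring.Sum semiring using (sum-cong-≋)
  open import Algebra.Properties.Monoid.Mult +-monoid using (×-congʳ; ×-assocˡ)
  open import Algebra.Solver.CommutativeMonoid *-commutativeMonoid using (solve; prove; var; _⊕_; _⊜_)
  open import Algebra.Solver.CommutativeMonoid +-commutativeMonoid
    using () renaming (solve to +-solve; _⊕_ to _⊕ₐ_; _⊜_ to _⊜ₐ_; id to εₐ)
  open import Relation.Binary.Reasoning.Setoid setoid
  open Arithmetic
  open FieldFacts F
  open Sums commutativeSemiring
  open TensorAction commutativeSemiring using (_∙_)
  open Antipode using (antipode; antipode-∣; antipode-unique)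

  N : ℕ
  N = suc (suc L)

  open Weil F N ζ public

  ζ^2^N≈1 : ζ ^ (2 ℕ.^ N) ≈ 1#
  ζ^2^N≈1 = begin
    ζ ^ (2 ℕ.^ suc L ℕ.+ (2 ℕ.^ suc L ℕ.+ 0))  ≡⟨ ≡.cong (λ m → ζ ^ (2 ℕ.^ suc L ℕ.+ m)) (ℕ.+-identityʳ _) ⟩
    ζ ^ (2 ℕ.^ suc L ℕ.+ 2 ℕ.^ suc L)          ≈⟨ ^-homo-* ζ (2 ℕ.^ suc L) (2 ℕ.^ suc L) ⟩
    ζ ^ (2 ℕ.^ suc L) * ζ ^ (2 ℕ.^ suc L)      ≈⟨ *-cong ζ-half ζ-half ⟩
    - 1# * - 1#                                ≈⟨ -1*-1≈1 ⟩
    1#                                         ∎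

  ζ*ζinv≈1 : ζ * ζinv ≈ 1#
  ζ*ζinv≈1 = trans (reflexive (≡.cong (ζ ^_) (ℕ.m+[n∸m]≡n {1} {2 ℕ.^ N} (ℕ.m^n>0 2 N)))) ζ^2^N≈1

  private
    e-⊖ : ∀ m n → e (m ⊖ n) ≈ ζ ^ m * ζinv ^ n
    e-⊖ zero zero = sym (*-identityʳ 1#)
    e-⊖ (suc m) zero = sym (*-identityʳ _)
    e-⊖ zero (suc n) = sym (*-identityˡ _)
    e-⊖ (suc m) (suc n) = begin
      e (suc m ⊖ suc n)                         ≡⟨ ≡.cong e (ℤ.[1+m]⊖[1+n]≡m⊖n m n) ⟩
      e (m ⊖ n)                                 ≈⟨ e-⊖ m n ⟩
      ζ ^ m * ζinv ^ n                          ≈⟨ *-identityˡ _ ⟨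
      1# * (ζ ^ m * ζinv ^ n)                   ≈⟨ *-congʳ ζ*ζinv≈1 ⟨
      (ζ * ζinv) * (ζ ^ m * ζinv ^ n)
        ≈⟨ solve 4 (λ a b c d → (a ⊕ b) ⊕ (c ⊕ d) ⊜ (a ⊕ c) ⊕ (b ⊕ d)) refl ζ ζinv (ζ ^ m) (ζinv ^ n) ⟩
      ζ ^ suc m * ζinv ^ suc n                  ∎

  e-+ : ∀ x y → e (x ℤ.+ y) ≈ e x * e y
  e-+ (+ m) (+ n) = ^-homo-* ζ m n
  e-+ (+ m) -[1+ n ] = e-⊖ m (suc n)
  e-+ -[1+ m ] (+ n) = trans (e-⊖ n (suc m)) (*-comm _ _)
  e-+ -[1+ m ] -[1+ n ] = begin
    ζinv ^ suc (suc (m ℕ.+ n))     ≡⟨ ≡.cong (λ k → ζinv ^ suc k) (ℕ.+-suc m n) ⟨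
    ζinv ^ (suc m ℕ.+ suc n)       ≈⟨ ^-homo-* ζinv (suc m) (suc n) ⟩
    ζinv ^ suc m * ζinv ^ suc n    ∎

  e-*ℕ : ∀ n x → e (+ n ℤ.* x) ≈ e x ^ n
  e-*ℕ zero x = reflexive (≡.cong e (ℤ.*-zeroˡ x))
  e-*ℕ (suc n) x = begin
    e (+ suc n ℤ.* x)       ≡⟨ ≡.cong e (ℤ.suc-* (+ n) x) ⟩
    e (x ℤ.+ + n ℤ.* x)     ≈⟨ e-+ x (+ n ℤ.* x) ⟩
    e x * e (+ n ℤ.* x)     ≈⟨ *-congˡ (e-*ℕ n x) ⟩
    e x ^ suc n             ∎

  e-neg : ∀ x → e (ℤ.- x) * e x ≈ 1#
  e-neg x = trans (sym (e-+ (ℤ.- x) x)) (reflexive (≡.cong e (ℤ.+-inverseˡ x)))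

  e[t·2ᴺ]≈1 : ∀ t → e (t ℤ.* pow₂ N) ≈ 1#
  e[t·2ᴺ]≈1 (+ k) = begin
    e (+ k ℤ.* pow₂ N)       ≡⟨ ≡.cong e (≡.sym (ℤ.pos-* k (2 ℕ.^ N))) ⟩
    ζ ^ (k ℕ.* 2 ℕ.^ N)      ≡⟨ ≡.cong (ζ ^_) (ℕ.*-comm k (2 ℕ.^ N)) ⟩
    ζ ^ (2 ℕ.^ N ℕ.* k)      ≈⟨ ^-assocʳ ζ (2 ℕ.^ N) k ⟨
    (ζ ^ (2 ℕ.^ N)) ^ k      ≈⟨ ^-congˡ k ζ^2^N≈1 ⟩
    1# ^ k                   ≈⟨ 1^n≈1 k ⟩
    1#                       ∎
  e[t·2ᴺ]≈1 -[1+ k ] = begin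
    e (-[1+ k ] ℤ.* pow₂ N)                 ≡⟨ ≡.cong e (≡.sym (ℤ.neg-distribˡ-* (+ suc k) (pow₂ N))) ⟩
    e (ℤ.- (+ suc k ℤ.* pow₂ N))            ≈⟨ *-identityʳ _ ⟨
    e (ℤ.- (+ suc k ℤ.* pow₂ N)) * 1#       ≈⟨ *-congˡ (e[t·2ᴺ]≈1 (+ suc k)) ⟨
    e (ℤ.- (+ suc k ℤ.* pow₂ N)) * e (+ suc k ℤ.* pow₂ N) ≈⟨ e-neg (+ suc k ℤ.* pow₂ N) ⟩
    1#                                      ∎

  e-cong-mod : ∀ {x y} → pow₂ N ∣ x ℤ.- y → e x ≈ e y
  e-cong-mod {x} {y} (divides t x-y≡t2ᴺ) = begin
    e x                           ≡⟨ ≡.cong e (split x y) ⟩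
    e (y ℤ.+ (x ℤ.- y))           ≈⟨ e-+ y (x ℤ.- y) ⟩
    e y * e (x ℤ.- y)             ≈⟨ *-congˡ (trans (reflexive (≡.cong e x-y≡t2ᴺ)) (e[t·2ᴺ]≈1 t)) ⟩
    e y * 1#                      ≈⟨ *-identityʳ _ ⟩
    e y                           ∎
    where
    split : ∀ x y → x ≡ y ℤ.+ (x ℤ.- y)
    split = solve-∀

  e-half-odd : ∀ u → e (pow₂ (suc L) ℤ.* (+ 2 ℤ.* u ℤ.+ + 1)) ≈ - 1#
  e-half-odd u = trans (e-cong-mod {pow₂ (suc L) ℤ.* (+ 2 ℤ.* u ℤ.+ + 1)} {pow₂ (suc L)} (divides u eq)) ζ-half
    where
    eq′ : ∀ h u → h ℤ.* (+ 2 ℤ.* u ℤ.+ + 1) ℤ.- h ≡ u ℤ.* (+ 2 ℤ.* h)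
    eq′ = solve-∀
    eq : pow₂ (suc L) ℤ.* (+ 2 ℤ.* u ℤ.+ + 1) ℤ.- pow₂ (suc L) ≡ u ℤ.* pow₂ N
    eq = ≡.trans (eq′ (pow₂ (suc L)) u) (≡.cong (u ℤ.*_) (≡.sym (pow₂-suc (suc L))))

  e[2ᵖm]≈1⇒2ʲ∣m : ∀ j p m → p ℕ.+ j ≡ N → e (pow₂ p ℤ.* m) ≈ 1# → pow₂ j ∣ m
  e[2ᵖm]≈1⇒2ʲ∣m zero p m _ _ = divides m (≡.sym (ℤ.*-identityʳ m))
  e[2ᵖm]≈1⇒2ʲ∣m (suc j) p m p+j+1≡N e≈1 with parity m
  ... | u , inj₁ ≡.refl =
    ≡.subst (_∣ + 2 ℤ.* u) (≡.sym (pow₂-suc j)) (*-monoʳ-∣ (+ 2)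
      (e[2ᵖm]≈1⇒2ʲ∣m j (suc p) u (≡.trans (≡.sym (ℕ.+-suc p j)) p+j+1≡N)
        (trans (reflexive (≡.cong e (≡.sym 2ᵖ[2u]≡2ᵖ⁺¹u))) e≈1)))
    where
    2ᵖ[2u]≡2ᵖ⁺¹u : pow₂ p ℤ.* (+ 2 ℤ.* u) ≡ pow₂ (suc p) ℤ.* u
    2ᵖ[2u]≡2ᵖ⁺¹u = ≡.trans (assoc-comm (pow₂ p) u) (≡.cong (ℤ._* u) (≡.sym (pow₂-suc p)))
      where
      assoc-comm : ∀ m u → m ℤ.* (+ 2 ℤ.* u) ≡ + 2 ℤ.* m ℤ.* u
      assoc-comm = solve-∀
  ... | u , inj₂ ≡.refl = ⊥-elim (-1≉1 (begin
    - 1#                                             ≈⟨ e-half-odd u ⟨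
    e (pow₂ (suc L) ℤ.* (+ 2 ℤ.* u ℤ.+ + 1))         ≡⟨ ≡.cong e 2ᴸ⁺¹m≡2ʲ[2ᵖm] ⟩
    e (pow₂ j ℤ.* (pow₂ p ℤ.* (+ 2 ℤ.* u ℤ.+ + 1)))  ≈⟨ e-*ℕ (2 ℕ.^ j) _ ⟩
    e (pow₂ p ℤ.* (+ 2 ℤ.* u ℤ.+ + 1)) ^ (2 ℕ.^ j)   ≈⟨ ^-congˡ (2 ℕ.^ j) e≈1 ⟩
    1# ^ (2 ℕ.^ j)                                   ≈⟨ 1^n≈1 (2 ℕ.^ j) ⟩
    1#                                               ∎))
    where
    j+p≡L+1 : j ℕ.+ p ≡ suc L
    j+p≡L+1 = ℕ.suc-injective (≡.trans (≡.trans (≡.cong suc (ℕ.+-comm j p)) (≡.sym (ℕ.+-suc p j))) p+j+1≡N)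
    2ᴸ⁺¹m≡2ʲ[2ᵖm] : pow₂ (suc L) ℤ.* (+ 2 ℤ.* u ℤ.+ + 1) ≡ pow₂ j ℤ.* (pow₂ p ℤ.* (+ 2 ℤ.* u ℤ.+ + 1))
    2ᴸ⁺¹m≡2ʲ[2ᵖm] = ≡.trans (≡.cong (λ k → pow₂ k ℤ.* (+ 2 ℤ.* u ℤ.+ + 1)) (≡.sym j+p≡L+1))
                    (≡.trans (≡.cong (ℤ._* (+ 2 ℤ.* u ℤ.+ + 1)) (pow₂-+ j p)) (ℤ.*-assoc (pow₂ j) (pow₂ p) _))

  e≈1⇒2ᴺ∣ : ∀ {x} → e x ≈ 1# → pow₂ N ∣ x
  e≈1⇒2ᴺ∣ {x} e≈1 = e[2ᵖm]≈1⇒2ʲ∣m N 0 x ≡.refl (trans (reflexive (≡.cong e (ℤ.*-identityˡ x))) e≈1)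

  χ : ℤ → ℕ → Carrier
  χ a x = e (ℤ.- (a ℤ.* + x))

  χ-cong : ∀ a {x y} → x ≡ y → χ a x ≈ χ a y
  χ-cong a x≡y = reflexive (≡.cong (χ a) x≡y)

  χ-+ : ∀ a x y → χ a (x ℕ.+ y) ≈ χ a x * χ a y
  χ-+ a x y = trans (reflexive (≡.cong e (≡.trans (≡.cong (λ z → ℤ.- (a ℤ.* z)) (ℤ.pos-+ x y)) (neg-distrib a (+ x) (+ y)))))
                    (e-+ (ℤ.- (a ℤ.* + x)) (ℤ.- (a ℤ.* + y)))
    where
    neg-distrib : ∀ a x y → ℤ.- (a ℤ.* (x ℤ.+ y)) ≡ ℤ.- (a ℤ.* x) ℤ.+ ℤ.- (a ℤ.* y)
    neg-distrib = solve-∀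

  χ-0 : ∀ a → χ a 0 ≈ 1#
  χ-0 a = reflexive (≡.cong (λ z → e (ℤ.- z)) (ℤ.*-zeroʳ a))

  χ-2ᴺ : ∀ a t → χ a (2 ℕ.^ N ℕ.* t) ≈ 1#
  χ-2ᴺ a t = trans (reflexive (≡.cong e (≡.trans (≡.cong (λ z → ℤ.- (a ℤ.* z)) (ℤ.pos-* (2 ℕ.^ N) t)) (swap a (pow₂ N) (+ t)))))
                   (e[t·2ᴺ]≈1 (ℤ.- (a ℤ.* + t)))
    where
    swap : ∀ a p t → ℤ.- (a ℤ.* (p ℤ.* t)) ≡ ℤ.- (a ℤ.* t) ℤ.* p
    swap = solve-∀

  χ-periodic : ∀ a x t → χ a (x ℕ.+ 2 ℕ.^ N ℕ.* t) ≈ χ a x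
  χ-periodic a x t = trans (χ-+ a x _) (trans (*-congˡ (χ-2ᴺ a t)) (*-identityʳ _))

  e[-_/4] : ℤ → Carrier
  e[- a /4] = χ a (2 ℕ.^ L)

  orthogonality-trivial : ∀ a r p t → p ℕ.+ r ≡ N →
                          sumℕ (2 ℕ.^ r) (λ γ → χ a (γ ℕ.* (2 ℕ.^ r ℕ.* t) ℕ.* 2 ℕ.^ p)) ≈ (2 ℕ.^ r) · 1#
  orthogonality-trivial a r p t p+r≡N =
    trans (sumℕ-cong (2 ℕ.^ r) λ γ → trans (χ-cong a (regroup γ)) (χ-2ᴺ a (γ ℕ.* t))) (sumℕ-const (2 ℕ.^ r) 1#)
    where
    regroup : ∀ γ → γ ℕ.* (2 ℕ.^ r ℕ.* t) ℕ.* 2 ℕ.^ p ≡ 2 ℕ.^ N ℕ.* (γ ℕ.* t)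
    regroup γ = ≡.trans (swap γ (2 ℕ.^ r) t (2 ℕ.^ p))
                        (≡.cong (ℕ._* (γ ℕ.* t)) (≡.trans (2ᵐ*2ⁿ≡2ᵐ⁺ⁿ r p) (≡.cong (2 ℕ.^_) (≡.trans (ℕ.+-comm r p) p+r≡N))))
      where
      swap : ∀ γ R t P → γ ℕ.* (R ℕ.* t) ℕ.* P ≡ R ℕ.* P ℕ.* (γ ℕ.* t)
      swap = ℕ-solve-∀

  -- For r + q = L + 1 this is Σ_{δ mod 2ʳ} e(−aδ²/2ʳ⁺¹), the conjugate Gauss sum of D_{2ʳ⁻¹}(a).
  gauss : ℤ → ℕ → ℕ → Carrier
  gauss a r q = sumℕ (2 ℕ.^ r) λ δ → χ a (δ ℕ.* δ ℕ.* 2 ℕ.^ q)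

  module OddCharacter {a u : ℤ} (a≡2u+1 : a ≡ + 2 ℤ.* u ℤ.+ + 1) where

    χ-half-odd : ∀ h → χ a (2 ℕ.^ suc L ℕ.* suc (2 ℕ.* h)) ≈ - 1#
    χ-half-odd h = trans (reflexive (≡.cong e exponent)) (e-half-odd w)
      where
      w : ℤ
      w = ℤ.- (+ 2 ℤ.* u ℤ.* + h ℤ.+ u ℤ.+ + h ℤ.+ + 1)
      rearrange : ∀ u p h → ℤ.- ((+ 2 ℤ.* u ℤ.+ + 1) ℤ.* (p ℤ.* (+ 1 ℤ.+ + 2 ℤ.* h)))
                            ≡ p ℤ.* (+ 2 ℤ.* ℤ.- (+ 2 ℤ.* u ℤ.* h ℤ.+ u ℤ.+ h ℤ.+ + 1) ℤ.+ + 1)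
      rearrange = solve-∀
      exponent : ℤ.- (a ℤ.* + (2 ℕ.^ suc L ℕ.* suc (2 ℕ.* h))) ≡ pow₂ (suc L) ℤ.* (+ 2 ℤ.* w ℤ.+ + 1)
      exponent = ≡.trans
        (≡.cong₂ (λ b z → ℤ.- (b ℤ.* z)) a≡2u+1
          (≡.trans (ℤ.pos-* (2 ℕ.^ suc L) _)
            (≡.cong (pow₂ (suc L) ℤ.*_) (≡.trans (ℤ.pos-+ 1 (2 ℕ.* h)) (≡.cong (λ z → + 1 ℤ.+ z) (ℤ.pos-* 2 h))))))
        (rearrange u (pow₂ (suc L)) (+ h))

    orthogonality : ∀ r p m → p ℕ.+ r ≡ N → ¬ (2 ℕ.^ r ∣ℕ m) →
                    sumℕ (2 ℕ.^ r) (λ γ → χ a (γ ℕ.* m ℕ.* 2 ℕ.^ p)) ≈ 0#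
    orthogonality zero p m _ 2⁰∤m = ⊥-elim (2⁰∤m (1∣ m))
    orthogonality (suc r) p m p+r+1≡N 2ʳ⁺¹∤m with parityℕ m
    ... | h , inj₂ ≡.refl = begin
      sumℕ (2 ℕ.* R) f                           ≈⟨ sumℕ-halves R f ⟩
      sumℕ R f + sumℕ R (λ i → f (R ℕ.+ i))      ≈⟨ +-congˡ (sumℕ-cong R shift) ⟩
      sumℕ R f + sumℕ R (λ i → - 1# * f i)       ≈⟨ +-congˡ (sumℕ-*ˡ R (- 1#) f) ⟨
      sumℕ R f + - 1# * sumℕ R f                 ≈⟨ +-congˡ (-1*x≈-x _) ⟩
      sumℕ R f - sumℕ R f                        ≈⟨ -‿inverseʳ _ ⟩
      0#                                         ∎
      where
      R = 2 ℕ.^ r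
      f : ℕ → Carrier
      f γ = χ a (γ ℕ.* suc (2 ℕ.* h) ℕ.* 2 ℕ.^ p)
      R2ᵖ≡2ᴸ⁺¹ : R ℕ.* 2 ℕ.^ p ≡ 2 ℕ.^ suc L
      R2ᵖ≡2ᴸ⁺¹ = ≡.trans (2ᵐ*2ⁿ≡2ᵐ⁺ⁿ r p) (≡.cong (2 ℕ.^_) (ℕ.suc-injective
                   (≡.trans (≡.cong suc (ℕ.+-comm r p)) (≡.trans (≡.sym (ℕ.+-suc p r)) p+r+1≡N))))
      expand : ∀ R i m P → (R ℕ.+ i) ℕ.* m ℕ.* P ≡ i ℕ.* m ℕ.* P ℕ.+ R ℕ.* P ℕ.* m
      expand = ℕ-solve-∀
      shift : ∀ i → f (R ℕ.+ i) ≈ - 1# * f i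
      shift i = begin
        f (R ℕ.+ i)                                   ≈⟨ χ-cong a (expand R i (suc (2 ℕ.* h)) (2 ℕ.^ p)) ⟩
        χ a (i ℕ.* suc (2 ℕ.* h) ℕ.* 2 ℕ.^ p ℕ.+ R ℕ.* 2 ℕ.^ p ℕ.* suc (2 ℕ.* h))
                                                      ≈⟨ χ-+ a _ _ ⟩
        f i * χ a (R ℕ.* 2 ℕ.^ p ℕ.* suc (2 ℕ.* h))   ≈⟨ *-congˡ (trans (χ-cong a (≡.cong (ℕ._* suc (2 ℕ.* h)) R2ᵖ≡2ᴸ⁺¹)) (χ-half-odd h)) ⟩
        f i * - 1#                                    ≈⟨ *-comm _ _ ⟩
        - 1# * f i                                    ∎
    ... | h , inj₁ ≡.refl = begin
      sumℕ (2 ℕ.* R) f                           ≈⟨ sumℕ-halves R f ⟩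
      sumℕ R f + sumℕ R (λ i → f (R ℕ.+ i))      ≈⟨ +-congˡ (sumℕ-cong R shift) ⟩
      sumℕ R f + sumℕ R f                        ≈⟨ +-cong half≈0 half≈0 ⟩
      0# + 0#                                    ≈⟨ +-identityʳ 0# ⟩
      0#                                         ∎
      where
      R = 2 ℕ.^ r
      f : ℕ → Carrier
      f γ = χ a (γ ℕ.* (2 ℕ.* h) ℕ.* 2 ℕ.^ p)
      2R2ᵖ≡2ᴺ : 2 ℕ.* (R ℕ.* 2 ℕ.^ p) ≡ 2 ℕ.^ N
      2R2ᵖ≡2ᴺ = ≡.cong (2 ℕ.*_) (≡.trans (2ᵐ*2ⁿ≡2ᵐ⁺ⁿ r p) (≡.cong (2 ℕ.^_) (ℕ.suc-injective
                   (≡.trans (≡.cong suc (ℕ.+-comm r p)) (≡.trans (≡.sym (ℕ.+-suc p r)) p+r+1≡N)))))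
      expand : ∀ R i h P → (R ℕ.+ i) ℕ.* (2 ℕ.* h) ℕ.* P ≡ i ℕ.* (2 ℕ.* h) ℕ.* P ℕ.+ 2 ℕ.* (R ℕ.* P) ℕ.* h
      expand = ℕ-solve-∀
      shift : ∀ i → f (R ℕ.+ i) ≈ f i
      shift i = trans (χ-cong a (≡.trans (expand R i h (2 ℕ.^ p)) (≡.cong (λ z → i ℕ.* (2 ℕ.* h) ℕ.* 2 ℕ.^ p ℕ.+ z ℕ.* h) 2R2ᵖ≡2ᴺ)))
                      (χ-periodic a _ h)
      regroup : ∀ i h P → i ℕ.* (2 ℕ.* h) ℕ.* P ≡ i ℕ.* h ℕ.* (2 ℕ.* P)
      regroup = ℕ-solve-∀
      half≈0 : sumℕ R f ≈ 0#
      half≈0 = trans (sumℕ-cong R λ i → χ-cong a (regroup i h (2 ℕ.^ p)))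
                     (orthogonality r (suc p) h (≡.trans (≡.sym (ℕ.+-suc p r)) p+r+1≡N)
                       λ 2ʳ∣h → 2ʳ⁺¹∤m (*-monoʳ-∣ℕ 2 2ʳ∣h))

    e[-a/4]²≈-1 : e[- a /4] * e[- a /4] ≈ - 1#
    e[-a/4]²≈-1 = trans (sym (χ-+ a (2 ℕ.^ L) (2 ℕ.^ L))) (trans (χ-cong a (double (2 ℕ.^ L))) (χ-half-odd 0))
      where
      double : ∀ x → x ℕ.+ x ≡ 2 ℕ.* x ℕ.* 1
      double = ℕ-solve-∀

    gauss-step : ∀ r q → 3 ℕ.+ r ℕ.+ q ≡ suc L →
                 gauss a (3 ℕ.+ r) q ≈ gauss a (1 ℕ.+ r) (2 ℕ.+ q) + gauss a (1 ℕ.+ r) (2 ℕ.+ q)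
    gauss-step r q 3+r+q≡L+1 = begin
      sumℕ (2 ℕ.* B) f                                   ≈⟨ sumℕ-halves B f ⟩
      sumℕ B f + sumℕ B (λ δ → f (B ℕ.+ δ))              ≈⟨ +-congˡ (sumℕ-cong B shift) ⟩
      sumℕ B f + sumℕ B (λ δ → f δ * sign δ)             ≈⟨ sumℕ-distrib B f (λ δ → f δ * sign δ) ⟨
      sumℕ B g                                           ≈⟨ sumℕ-pairs (2 ℕ.^ suc r) g ⟩
      sumℕ (2 ℕ.^ suc r) (λ i → g (2 ℕ.* i) + g (suc (2 ℕ.* i)))
                                                         ≈⟨ sumℕ-cong (2 ℕ.^ suc r) pair ⟩
      sumℕ (2 ℕ.^ suc r) (λ i → f′ i + f′ i)             ≈⟨ sumℕ-distrib (2 ℕ.^ suc r) f′ f′ ⟩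
      gauss a (1 ℕ.+ r) (2 ℕ.+ q) + gauss a (1 ℕ.+ r) (2 ℕ.+ q) ∎
      where
      B = 2 ℕ.^ (2 ℕ.+ r)
      f f′ sign g : ℕ → Carrier
      f δ = χ a (δ ℕ.* δ ℕ.* 2 ℕ.^ q)
      f′ i = χ a (i ℕ.* i ℕ.* 2 ℕ.^ (2 ℕ.+ q))
      sign δ = χ a (2 ℕ.^ suc L ℕ.* δ)
      g δ = f δ + f δ * sign δ
      2B2^q≡2ᴸ⁺¹ : 2 ℕ.* (B ℕ.* 2 ℕ.^ q) ≡ 2 ℕ.^ suc L
      2B2^q≡2ᴸ⁺¹ = ≡.trans (≡.cong (2 ℕ.*_) (2ᵐ*2ⁿ≡2ᵐ⁺ⁿ (2 ℕ.+ r) q)) (≡.cong (2 ℕ.^_) 3+r+q≡L+1)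
      BB2^q≡2ᴺ2ʳ : B ℕ.* B ℕ.* 2 ℕ.^ q ≡ 2 ℕ.^ N ℕ.* 2 ℕ.^ r
      BB2^q≡2ᴺ2ʳ = ≡.trans (≡.cong (ℕ._* 2 ℕ.^ q) (2ᵐ*2ⁿ≡2ᵐ⁺ⁿ (2 ℕ.+ r) (2 ℕ.+ r)))
                   (≡.trans (2ᵐ*2ⁿ≡2ᵐ⁺ⁿ ((2 ℕ.+ r) ℕ.+ (2 ℕ.+ r)) q)
                   (≡.trans (≡.cong (2 ℕ.^_) (≡.trans (exponents r q) (≡.cong (λ m → suc m ℕ.+ r) 3+r+q≡L+1)))
                            (≡.sym (2ᵐ*2ⁿ≡2ᵐ⁺ⁿ N r))))
        where
        exponents : ∀ r q → (2 ℕ.+ r) ℕ.+ (2 ℕ.+ r) ℕ.+ q ≡ suc (3 ℕ.+ r ℕ.+ q) ℕ.+ r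
        exponents = ℕ-solve-∀
      expand : ∀ B δ P → (B ℕ.+ δ) ℕ.* (B ℕ.+ δ) ℕ.* P ≡ δ ℕ.* δ ℕ.* P ℕ.+ 2 ℕ.* (B ℕ.* P) ℕ.* δ ℕ.+ B ℕ.* B ℕ.* P
      expand = ℕ-solve-∀
      shift : ∀ δ → f (B ℕ.+ δ) ≈ f δ * sign δ
      shift δ = begin
        f (B ℕ.+ δ)                                        ≈⟨ χ-cong a (≡.trans (expand B δ (2 ℕ.^ q))
                                                                 (≡.cong₂ (λ m n → δ ℕ.* δ ℕ.* 2 ℕ.^ q ℕ.+ m ℕ.* δ ℕ.+ n) 2B2^q≡2ᴸ⁺¹ BB2^q≡2ᴺ2ʳ)) ⟩
        χ a (δ ℕ.* δ ℕ.* 2 ℕ.^ q ℕ.+ 2 ℕ.^ suc L ℕ.* δ ℕ.+ 2 ℕ.^ N ℕ.* 2 ℕ.^ r)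
                                                           ≈⟨ χ-periodic a _ (2 ℕ.^ r) ⟩
        χ a (δ ℕ.* δ ℕ.* 2 ℕ.^ q ℕ.+ 2 ℕ.^ suc L ℕ.* δ)    ≈⟨ χ-+ a _ _ ⟩
        f δ * sign δ                                       ∎
      pair : ∀ i → g (2 ℕ.* i) + g (suc (2 ℕ.* i)) ≈ f′ i + f′ i
      pair i = begin
        (f (2 ℕ.* i) + f (2 ℕ.* i) * sign (2 ℕ.* i)) + (f (suc (2 ℕ.* i)) + f (suc (2 ℕ.* i)) * sign (suc (2 ℕ.* i)))
          ≈⟨ +-cong (+-congˡ (*-congˡ sign-even)) (+-congˡ (*-congˡ (χ-half-odd i))) ⟩
        (f (2 ℕ.* i) + f (2 ℕ.* i) * 1#) + (f (suc (2 ℕ.* i)) + f (suc (2 ℕ.* i)) * - 1#)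
          ≈⟨ +-cong (+-congˡ (*-identityʳ _)) (+-congˡ (trans (*-comm _ _) (-1*x≈-x _))) ⟩
        (f (2 ℕ.* i) + f (2 ℕ.* i)) + (f (suc (2 ℕ.* i)) - f (suc (2 ℕ.* i)))
          ≈⟨ +-cong (+-cong f-even f-even) (-‿inverseʳ _) ⟩
        (f′ i + f′ i) + 0#
          ≈⟨ +-identityʳ _ ⟩
        f′ i + f′ i ∎
        where
        regroup : ∀ M i → M ℕ.* (2 ℕ.* i) ≡ 2 ℕ.* M ℕ.* i
        regroup = ℕ-solve-∀
        sign-even : sign (2 ℕ.* i) ≈ 1#
        sign-even = trans (χ-cong a (regroup (2 ℕ.^ suc L) i)) (χ-2ᴺ a i)
        quadruple : ∀ i P → 2 ℕ.* i ℕ.* (2 ℕ.* i) ℕ.* P ≡ i ℕ.* i ℕ.* (2 ℕ.* (2 ℕ.* P))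
        quadruple = ℕ-solve-∀
        f-even : f (2 ℕ.* i) ≈ f′ i
        f-even = χ-cong a (quadruple i (2 ℕ.^ q))

    gauss² : ∀ r q → suc r ℕ.+ q ≡ suc L → gauss a (suc r) q * gauss a (suc r) q ≈ (2 ℕ.^ suc r) · e[- a /4]
    gauss² zero q 1+q≡1+L with ℕ.suc-injective 1+q≡1+L
    ... | ≡.refl = begin
      G * G                                ≈⟨ *-cong G≈1+y G≈1+y ⟩
      (1# + y) * (1# + y)                  ≈⟨ distribʳ (1# + y) 1# y ⟩
      1# * (1# + y) + y * (1# + y)         ≈⟨ +-cong (*-identityˡ _) (distribˡ y 1# y) ⟩
      (1# + y) + (y * 1# + y * y)          ≈⟨ +-congˡ (+-cong (*-identityʳ y) e[-a/4]²≈-1) ⟩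
      (1# + y) + (y + - 1#)                ≈⟨ +-solve 3 (λ o y m → (o ⊕ₐ y) ⊕ₐ (y ⊕ₐ m) ⊜ₐ (o ⊕ₐ m) ⊕ₐ (y ⊕ₐ y)) refl 1# y (- 1#) ⟩
      (1# - 1#) + (y + y)                  ≈⟨ +-cong (-‿inverseʳ 1#) (sym (2·x≈x+x y)) ⟩
      0# + 2 · y                           ≈⟨ +-identityˡ _ ⟩
      2 · y                                ∎
      where
      G = gauss a 1 L
      y = e[- a /4]
      G≈1+y : G ≈ 1# + y
      G≈1+y = +-cong (χ-0 a) (trans (+-identityʳ _) (χ-cong a (ℕ.*-identityˡ (2 ℕ.^ L))))
    gauss² (suc zero) q 2+q≡1+L with ℕ.suc-injective 2+q≡1+L
    ... | ≡.refl = begin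
      G * G                          ≈⟨ *-cong G≈x+x G≈x+x ⟩
      (x + x) * (x + x)              ≈⟨ [x+x]²≈2·2·x² x ⟩
      2 · (2 · (x * x))              ≈⟨ ×-congʳ 2 (×-congʳ 2 x²≈y) ⟩
      2 · (2 · e[- a /4])            ≈⟨ ×-assocˡ e[- a /4] 2 2 ⟩
      4 · e[- a /4]                  ∎
      where
      G = gauss a 2 q
      x = χ a (2 ℕ.^ q)
      x²≈y : x * x ≈ e[- a /4]
      x²≈y = trans (sym (χ-+ a (2 ℕ.^ q) (2 ℕ.^ q))) (χ-cong a (≡.cong (2 ℕ.^ q ℕ.+_) (≡.sym (ℕ.+-identityʳ (2 ℕ.^ q)))))
      four : ∀ P → 2 ℕ.* 2 ℕ.* P ≡ 2 ℕ.* (2 ℕ.* P) ℕ.* 1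
      four = ℕ-solve-∀
      nine : ∀ P → 3 ℕ.* 3 ℕ.* P ≡ P ℕ.+ 2 ℕ.* (2 ℕ.* (2 ℕ.* P)) ℕ.* 1
      nine = ℕ-solve-∀
      G≈x+x : G ≈ x + x
      G≈x+x = begin
        χ a 0 + (χ a (1 ℕ.* 1 ℕ.* 2 ℕ.^ q) + (χ a (2 ℕ.* 2 ℕ.* 2 ℕ.^ q) + (χ a (3 ℕ.* 3 ℕ.* 2 ℕ.^ q) + 0#)))
          ≈⟨ +-cong (χ-0 a) (+-cong (χ-cong a (ℕ.*-identityˡ (2 ℕ.^ q)))
               (+-cong (trans (χ-cong a (four (2 ℕ.^ q))) (χ-half-odd 0))
                 (+-cong (trans (χ-cong a (nine (2 ℕ.^ q))) (χ-periodic a (2 ℕ.^ q) 1)) refl))) ⟩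
        1# + (x + (- 1# + (x + 0#)))
          ≈⟨ +-solve 3 (λ o x m → o ⊕ₐ (x ⊕ₐ (m ⊕ₐ (x ⊕ₐ εₐ))) ⊜ₐ (o ⊕ₐ m) ⊕ₐ (x ⊕ₐ x)) refl 1# x (- 1#) ⟩
        (1# - 1#) + (x + x)        ≈⟨ +-congʳ (-‿inverseʳ 1#) ⟩
        0# + (x + x)               ≈⟨ +-identityˡ _ ⟩
        x + x                      ∎
    gauss² (suc (suc r)) q 3+r+q≡1+L = begin
      G * G                                         ≈⟨ *-cong G≈G′+G′ G≈G′+G′ ⟩
      (G′ + G′) * (G′ + G′)                         ≈⟨ [x+x]²≈2·2·x² G′ ⟩
      2 · (2 · (G′ * G′))                           ≈⟨ ×-congʳ 2 (×-congʳ 2 (gauss² r (2 ℕ.+ q) (≡.trans (reindex r q) 3+r+q≡1+L))) ⟩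
      2 · (2 · ((2 ℕ.^ suc r) · e[- a /4]))         ≈⟨ ×-congʳ 2 (×-assocˡ e[- a /4] 2 (2 ℕ.^ suc r)) ⟩
      2 · ((2 ℕ.^ suc (suc r)) · e[- a /4])         ≈⟨ ×-assocˡ e[- a /4] 2 (2 ℕ.^ suc (suc r)) ⟩
      (2 ℕ.^ suc (suc (suc r))) · e[- a /4]         ∎
      where
      G = gauss a (3 ℕ.+ r) q
      G′ = gauss a (1 ℕ.+ r) (2 ℕ.+ q)
      G≈G′+G′ : G ≈ G′ + G′
      G≈G′+G′ = gauss-step r q 3+r+q≡1+L
      reindex : ∀ r q → suc r ℕ.+ (2 ℕ.+ q) ≡ 3 ℕ.+ r ℕ.+ q
      reindex = ℕ-solve-∀

  ρT-diagonal : ∀ k a (β : Fin (size k)) → ρ k a T β β ≈ eQ k a (toℕ β)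
  ρT-diagonal k a β with β ≟ β
  ... | yes _ = refl
  ... | no β≢β = ⊥-elim (β≢β ≡.refl)

  ρT-off-diagonal : ∀ k a (β γ : Fin (size k)) → γ ≢ β → ρ k a T β γ ≈ 0#
  ρT-off-diagonal k a β γ γ≢β with β ≟ γ
  ... | yes β≡γ = ⊥-elim (γ≢β (≡.sym β≡γ))
  ... | no _ = refl

  module Factor (k : ℕ) (k≤L : k ℕ.≤ L) {a u : ℤ} (a≡2u+1 : a ≡ + 2 ℤ.* u ℤ.+ + 1) where

    open OddCharacter {a} {u} a≡2u+1

    n : ℕ
    n = size k

    -- In D_{2ᵏ}(a) one has Q(γ) = aγ²·2^q/2ᴺ and B(γ, β) = aγβ·2ᵖ/2ᴺ.
    p q : ℕ
    p = N ℕ.∸ (k ℕ.+ 1)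
    q = N ℕ.∸ (k ℕ.+ 2)

    p+n≡N : p ℕ.+ suc k ≡ N
    p+n≡N = ≡.trans (≡.cong (p ℕ.+_) (ℕ.+-comm 1 k)) (ℕ.m∸n+n≡m k+1≤N)
      where
      k+1≤N : k ℕ.+ 1 ℕ.≤ N
      k+1≤N = ℕ.≤-trans (ℕ.≤-reflexive (ℕ.+-comm k 1)) (ℕ.s≤s (ℕ.m≤n⇒m≤1+n k≤L))

    1+k+q≡1+L : suc k ℕ.+ q ≡ suc L
    1+k+q≡1+L = ℕ.suc-injective (≡.trans (≡.cong (ℕ._+ q) (ℕ.+-comm 2 k)) (ℕ.m+[n∸m]≡n k+2≤N))
      where
      k+2≤N : k ℕ.+ 2 ℕ.≤ N
      k+2≤N = ℕ.≤-trans (ℕ.≤-reflexive (ℕ.+-comm k 2)) (ℕ.s≤s (ℕ.s≤s k≤L))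

    n·1≉0 : ¬ (n · 1# ≈ 0#)
    n·1≉0 n·1≈0 = ℕ.>⇒≢ (ℕ.m^n>0 2 (suc k)) (char0 n n·1≈0)

    n⁻¹ : Carrier
    n⁻¹ = (n · 1#) ⁻¹

    n⁻¹*n≈1 : n⁻¹ * (n · 1#) ≈ 1#
    n⁻¹*n≈1 = trans (*-comm n⁻¹ (n · 1#)) (⁻¹-inv (n · 1#) n·1≉0)

    Ḡ : Carrier
    Ḡ = gaussConj k a

    Ḡ²≈n*e[-a/4] : Ḡ * Ḡ ≈ (n · 1#) * e[- a /4]
    Ḡ²≈n*e[-a/4] = begin
      Ḡ * Ḡ                     ≈⟨ gauss² k q 1+k+q≡1+L ⟩
      n · e[- a /4]             ≈⟨ ×-congʳ n (*-identityˡ _) ⟨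
      n · (1# * e[- a /4])      ≈⟨ ×-assoc-* n 1# e[- a /4] ⟨
      (n · 1#) * e[- a /4]      ∎

    ρS*ρS : ∀ (β γ δ : Fin n) → ρ k a S β γ * ρ k a S γ δ
            ≈ (n⁻¹ * n⁻¹) * (Ḡ * Ḡ) * χ a (toℕ γ ℕ.* (toℕ β ℕ.+ toℕ δ) ℕ.* 2 ℕ.^ p)
    ρS*ρS β γ δ = begin
      (n⁻¹ * (Ḡ * χ a (g ℕ.* b ℕ.* 2 ℕ.^ p))) * (n⁻¹ * (Ḡ * χ a (d ℕ.* g ℕ.* 2 ℕ.^ p)))
        ≈⟨ prove 4 ((var 0F ⊕ (var 1F ⊕ var 2F)) ⊕ (var 0F ⊕ (var 1F ⊕ var 3F)))
                   (((var 0F ⊕ var 0F) ⊕ (var 1F ⊕ var 1F)) ⊕ (var 2F ⊕ var 3F))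
                   (n⁻¹ ∷ Ḡ ∷ χ a (g ℕ.* b ℕ.* 2 ℕ.^ p) ∷ χ a (d ℕ.* g ℕ.* 2 ℕ.^ p) ∷ []) ⟩
      (n⁻¹ * n⁻¹) * (Ḡ * Ḡ) * (χ a (g ℕ.* b ℕ.* 2 ℕ.^ p) * χ a (d ℕ.* g ℕ.* 2 ℕ.^ p))
        ≈⟨ *-congˡ (trans (sym (χ-+ a _ _)) (χ-cong a (factor g b d (2 ℕ.^ p)))) ⟩
      (n⁻¹ * n⁻¹) * (Ḡ * Ḡ) * χ a (g ℕ.* (b ℕ.+ d) ℕ.* 2 ℕ.^ p) ∎
      where
      g = toℕ γ
      b = toℕ β
      d = toℕ δ
      factor : ∀ g b d P → g ℕ.* b ℕ.* P ℕ.+ d ℕ.* g ℕ.* P ≡ g ℕ.* (b ℕ.+ d) ℕ.* P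
      factor = ℕ-solve-∀

    ρS∙ρS≈ : ∀ (β δ : Fin n) → (ρ k a S ∙ ρ k a S) β δ
             ≈ (n⁻¹ * n⁻¹) * (Ḡ * Ḡ) * sumℕ n (λ γ → χ a (γ ℕ.* (toℕ β ℕ.+ toℕ δ) ℕ.* 2 ℕ.^ p))
    ρS∙ρS≈ β δ = trans (sum-cong-≋ {n} {λ γ → ρ k a S β γ * ρ k a S γ δ} {λ γ → C * f (toℕ γ)} λ γ → ρS*ρS β γ δ)
                       (sym (sumℕ-*ˡ n C f))
      where
      C = (n⁻¹ * n⁻¹) * (Ḡ * Ḡ)
      f : ℕ → Carrier
      f γ = χ a (γ ℕ.* (toℕ β ℕ.+ toℕ δ) ℕ.* 2 ℕ.^ p)

    ρS∙ρS-off : ∀ (β δ : Fin n) → ¬ (n ∣ℕ toℕ β ℕ.+ toℕ δ) → (ρ k a S ∙ ρ k a S) β δ ≈ 0#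
    ρS∙ρS-off β δ n∤β+δ = trans (ρS∙ρS≈ β δ) (trans (*-congˡ (orthogonality (suc k) p _ p+n≡N n∤β+δ)) (zeroʳ _))

    ρS∙ρS-antidiagonal : ∀ (β δ : Fin n) → n ∣ℕ toℕ β ℕ.+ toℕ δ → (ρ k a S ∙ ρ k a S) β δ ≈ e[- a /4]
    ρS∙ρS-antidiagonal β δ (divides t β+δ≡tn) = begin
      (ρ k a S ∙ ρ k a S) β δ
        ≈⟨ ρS∙ρS≈ β δ ⟩
      C * sumℕ n (λ γ → χ a (γ ℕ.* (toℕ β ℕ.+ toℕ δ) ℕ.* 2 ℕ.^ p))
        ≈⟨ *-congˡ (sumℕ-cong n λ γ → χ-cong a (≡.cong (λ m → γ ℕ.* m ℕ.* 2 ℕ.^ p) (≡.trans β+δ≡tn (ℕ.*-comm t n)))) ⟩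
      C * sumℕ n (λ γ → χ a (γ ℕ.* (n ℕ.* t) ℕ.* 2 ℕ.^ p))
        ≈⟨ *-congˡ (orthogonality-trivial a (suc k) p t p+n≡N) ⟩
      (n⁻¹ * n⁻¹) * (Ḡ * Ḡ) * (n · 1#)
        ≈⟨ *-congʳ (*-congˡ Ḡ²≈n*e[-a/4]) ⟩
      (n⁻¹ * n⁻¹) * ((n · 1#) * e[- a /4]) * (n · 1#)
        ≈⟨ prove 3 (((var 0F ⊕ var 0F) ⊕ (var 1F ⊕ var 2F)) ⊕ var 1F)
                   (((var 0F ⊕ var 1F) ⊕ (var 0F ⊕ var 1F)) ⊕ var 2F)
                   (n⁻¹ ∷ (n · 1#) ∷ e[- a /4] ∷ []) ⟩
      (n⁻¹ * (n · 1#)) * (n⁻¹ * (n · 1#)) * e[- a /4]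
        ≈⟨ *-congʳ (*-cong n⁻¹*n≈1 n⁻¹*n≈1) ⟩
      (1# * 1#) * e[- a /4]
        ≈⟨ trans (*-congʳ (*-identityˡ 1#)) (*-identityˡ _) ⟩
      e[- a /4] ∎
      where
      C = (n⁻¹ * n⁻¹) * (Ḡ * Ḡ)

    ρS∙ρS-antipode : ∀ (β : Fin n) → (ρ k a S ∙ ρ k a S) β (antipode β) ≈ e[- a /4]
    ρS∙ρS-antipode β = ρS∙ρS-antidiagonal β (antipode β) (antipode-∣ β)

    ρS∙ρS-off-antipode : ∀ (β δ : Fin n) → δ ≢ antipode β → (ρ k a S ∙ ρ k a S) β δ ≈ 0#
    ρS∙ρS-off-antipode β δ δ≢-β with n ∣ℕ? toℕ β ℕ.+ toℕ δ
    ... | yes n∣β+δ = ⊥-elim (δ≢-β (antipode-unique n∣β+δ))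
    ... | no n∤β+δ = ρS∙ρS-off β δ n∤β+δ

module Invariants {c ℓ} (F : Char0Field c ℓ) (k₁ k₂ : ℕ) (ζ : Char0Field.Carrier F)
                  (ζ-half : Char0Field._≈_ F (Char0Field._^_ F ζ (2 ℕ.^ suc (suc (k₁ ℕ.+ k₂)))) (Char0Field.-_ F (Char0Field.1# F)))
                  {a₁ a₂ u₁ u₂ w s : ℤ} (a₁≡2u₁+1 : a₁ ≡ + 2 ℤ.* u₁ ℤ.+ + 1) (a₂≡2u₂+1 : a₂ ≡ + 2 ℤ.* u₂ ℤ.+ + 1)
                  (a₁a₂≡4w+1 : a₁ ℤ.* a₂ ≡ + 4 ℤ.* w ℤ.+ + 1) (a₁+a₂≡2[2s+1] : a₁ ℤ.+ a₂ ≡ + 2 ℤ.* (+ 2 ℤ.* s ℤ.+ + 1)) where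

  open import Data.Nat.Divisibility using (divides)
  open import Data.Integer.Divisibility.Signed using (_∣_; _∣?_; ∣ᵤ⇒∣; *-cancelˡ-∣; ∣m⇒∣-m)
  open import Data.List using ([]; _∷_; _++_; replicate)

  open Char0Field F hiding (zero)
  open import Algebra.Properties.Semiring.Exp semiring using (^-congˡ)
  open import Algebra.Properties.Semiring.Sum semiring using (sum-cong-≋)
  open import Algebra.Properties.Ring ring using (-1*x≈-x; -‿injective)
  open import Algebra.Solver.CommutativeMonoid *-commutativeMonoid using (prove; var; _⊕_)
  open import Relation.Binary.Reasoning.Setoid setoid
  open Arithmetic
  open TensorAction commutativeSemiring
  open FieldFacts F
  open Antipode using (antipode; antipode-∣; antipode-involutive)

  L : ℕ
  L = suc (k₁ ℕ.+ k₂)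

  open Character F L ζ ζ-half

  private
    k₁≤L : k₁ ℕ.≤ L
    k₁≤L = ℕ.m≤n⇒m≤1+n (ℕ.m≤m+n k₁ k₂)
    k₂≤L : k₂ ℕ.≤ L
    k₂≤L = ℕ.m≤n⇒m≤1+n (ℕ.m≤n+m k₂ k₁)

  module C₁ = Factor k₁ k₁≤L {a₁} {u₁} a₁≡2u₁+1
  module C₂ = Factor k₂ k₂≤L {a₂} {u₂} a₂≡2u₂+1
  open BinaryForm a₁ a₂ k₁ k₂

  e[-a₁/4]*e[-a₂/4]≈-1 : e[- a₁ /4] * e[- a₂ /4] ≈ - 1#
  e[-a₁/4]*e[-a₂/4]≈-1 = begin
    e[- a₁ /4] * e[- a₂ /4]                  ≈⟨ e-+ (ℤ.- (a₁ ℤ.* X)) (ℤ.- (a₂ ℤ.* X)) ⟨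
    e (ℤ.- (a₁ ℤ.* X) ℤ.+ ℤ.- (a₂ ℤ.* X))    ≡⟨ ≡.cong e exponent ⟩
    χ (+ 2 ℤ.* s ℤ.+ + 1) (2 ℕ.^ suc L ℕ.* 1) ≈⟨ OddCharacter.χ-half-odd {u = s} ≡.refl 0 ⟩
    - 1#                                     ∎
    where
    X = + (2 ℕ.^ L)
    collect : ∀ a₁ a₂ X → ℤ.- (a₁ ℤ.* X) ℤ.+ ℤ.- (a₂ ℤ.* X) ≡ ℤ.- ((a₁ ℤ.+ a₂) ℤ.* X)
    collect = solve-∀
    regroup : ∀ s X → ℤ.- (+ 2 ℤ.* (+ 2 ℤ.* s ℤ.+ + 1) ℤ.* X) ≡ ℤ.- ((+ 2 ℤ.* s ℤ.+ + 1) ℤ.* (+ 2 ℤ.* X ℤ.* + 1))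
    regroup = solve-∀
    exponent : ℤ.- (a₁ ℤ.* X) ℤ.+ ℤ.- (a₂ ℤ.* X) ≡ ℤ.- ((+ 2 ℤ.* s ℤ.+ + 1) ℤ.* + (2 ℕ.^ suc L ℕ.* 1))
    exponent = ≡.trans (collect a₁ a₂ X) (≡.trans (≡.cong (λ m → ℤ.- (m ℤ.* X)) a₁+a₂≡2[2s+1])
                 (≡.trans (regroup s X) (≡.cong (λ m → ℤ.- ((+ 2 ℤ.* s ℤ.+ + 1) ℤ.* m))
                   (≡.sym (≡.trans (ℤ.pos-* (2 ℕ.^ suc L) 1) (≡.cong (ℤ._* + 1) (ℤ.pos-* 2 (2 ℕ.^ L))))))))

  λT : Fin (size k₁) → Fin (size k₂) → Carrier
  λT β₁ β₂ = eQ k₁ a₁ (toℕ β₁) * eQ k₂ a₂ (toℕ β₂)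

  act-T : ∀ x β₁ β₂ → actGen k₁ k₂ a₁ a₂ T x β₁ β₂ ≈ λT β₁ β₂ * x β₁ β₂
  act-T x β₁ β₂ = begin
    actGen k₁ k₂ a₁ a₂ T x β₁ β₂
      ≈⟨ ⊗-monomial (λ β → β) (λ β → β) (ρT-off-diagonal k₁ a₁) (ρT-off-diagonal k₂ a₂) x β₁ β₂ ⟩
    ρ k₁ a₁ T β₁ β₁ * (ρ k₂ a₂ T β₂ β₂ * x β₁ β₂)
      ≈⟨ *-cong (ρT-diagonal k₁ a₁ β₁) (*-congʳ (ρT-diagonal k₂ a₂ β₂)) ⟩
    eQ k₁ a₁ (toℕ β₁) * (eQ k₂ a₂ (toℕ β₂) * x β₁ β₂)
      ≈⟨ *-assoc _ _ _ ⟨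
    λT β₁ β₂ * x β₁ β₂ ∎

  act-Tʲ : ∀ j x β₁ β₂ → act k₁ k₂ a₁ a₂ (replicate j T) x β₁ β₂ ≈ λT β₁ β₂ ^ j * x β₁ β₂
  act-Tʲ zero x β₁ β₂ = sym (*-identityˡ _)
  act-Tʲ (suc j) x β₁ β₂ = begin
    actGen k₁ k₂ a₁ a₂ T (act k₁ k₂ a₁ a₂ (replicate j T) x) β₁ β₂ ≈⟨ act-T _ β₁ β₂ ⟩
    λT β₁ β₂ * act k₁ k₂ a₁ a₂ (replicate j T) x β₁ β₂              ≈⟨ *-congˡ (act-Tʲ j x β₁ β₂) ⟩
    λT β₁ β₂ * (λT β₁ β₂ ^ j * x β₁ β₂)                             ≈⟨ *-assoc _ _ _ ⟨
    λT β₁ β₂ ^ suc j * x β₁ β₂                                      ∎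

  act-S² : ∀ x β₁ β₂ → act k₁ k₂ a₁ a₂ (S ∷ S ∷ []) x β₁ β₂ ≈ - x (antipode β₁) (antipode β₂)
  act-S² x β₁ β₂ = begin
    act k₁ k₂ a₁ a₂ (S ∷ S ∷ []) x β₁ β₂
      ≈⟨ ⊗-∙ (ρ k₁ a₁ S) (ρ k₁ a₁ S) (ρ k₂ a₂ S) (ρ k₂ a₂ S) x β₁ β₂ ⟩
    ((ρ k₁ a₁ S ∙ ρ k₁ a₁ S) ⊗ (ρ k₂ a₂ S ∙ ρ k₂ a₂ S)) x β₁ β₂
      ≈⟨ ⊗-monomial antipode antipode C₁.ρS∙ρS-off-antipode C₂.ρS∙ρS-off-antipode x β₁ β₂ ⟩
    (ρ k₁ a₁ S ∙ ρ k₁ a₁ S) β₁ (antipode β₁) * ((ρ k₂ a₂ S ∙ ρ k₂ a₂ S) β₂ (antipode β₂) * x (antipode β₁) (antipode β₂))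
      ≈⟨ *-cong (C₁.ρS∙ρS-antipode β₁) (*-congʳ (C₂.ρS∙ρS-antipode β₂)) ⟩
    e[- a₁ /4] * (e[- a₂ /4] * x (antipode β₁) (antipode β₂))
      ≈⟨ *-assoc _ _ _ ⟨
    (e[- a₁ /4] * e[- a₂ /4]) * x (antipode β₁) (antipode β₂)
      ≈⟨ *-congʳ e[-a₁/4]*e[-a₂/4]≈-1 ⟩
    - 1# * x (antipode β₁) (antipode β₂)
      ≈⟨ -1*x≈-x _ ⟩
    - x (antipode β₁) (antipode β₂) ∎

  act-S²-injective : ∀ {x y} → act k₁ k₂ a₁ a₂ (S ∷ S ∷ []) x ≋ act k₁ k₂ a₁ a₂ (S ∷ S ∷ []) y → x ≋ y
  act-S²-injective {x} {y} S²x≋S²y γ₁ γ₂ = begin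
    x γ₁ γ₂                                       ≡⟨ ≡.cong₂ x (antipode-involutive γ₁) (antipode-involutive γ₂) ⟨
    x (antipode (antipode γ₁)) (antipode (antipode γ₂))
      ≈⟨ -‿injective (trans (sym (act-S² x -γ₁ -γ₂)) (trans (S²x≋S²y -γ₁ -γ₂) (act-S² y -γ₁ -γ₂))) ⟩
    y (antipode (antipode γ₁)) (antipode (antipode γ₂)) ≡⟨ ≡.cong₂ y (antipode-involutive γ₁) (antipode-involutive γ₂) ⟩
    y γ₁ γ₂                                       ∎
    where
    -γ₁ = antipode γ₁
    -γ₂ = antipode γ₂

  private
    reindex₁ : ∀ j → N ℕ.∸ (k₁ ℕ.+ j) ≡ 3 ℕ.+ k₂ ℕ.∸ j
    reindex₁ j = ≡.trans (≡.cong (ℕ._∸ (k₁ ℕ.+ j)) (reorder k₁ k₂)) (ℕ.[m+n]∸[m+o]≡n∸o k₁ (3 ℕ.+ k₂) j)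
      where
      reorder : ∀ k₁ k₂ → 3 ℕ.+ (k₁ ℕ.+ k₂) ≡ k₁ ℕ.+ (3 ℕ.+ k₂)
      reorder = ℕ-solve-∀

    reindex₂ : ∀ j → N ℕ.∸ (k₂ ℕ.+ j) ≡ 3 ℕ.+ k₁ ℕ.∸ j
    reindex₂ j = ≡.trans (≡.cong (ℕ._∸ (k₂ ℕ.+ j)) (reorder k₁ k₂)) (ℕ.[m+n]∸[m+o]≡n∸o k₂ (3 ℕ.+ k₁) j)
      where
      reorder : ∀ k₁ k₂ → 3 ℕ.+ (k₁ ℕ.+ k₂) ≡ k₂ ℕ.+ (3 ℕ.+ k₁)
      reorder = ℕ-solve-∀

    pos-x*y*2ᵐ : ∀ x y {m m′} → m ≡ m′ → + (x ℕ.* y ℕ.* 2 ℕ.^ m) ≡ + x ℤ.* + y ℤ.* pow₂ m′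
    pos-x*y*2ᵐ x y {m} ≡.refl = ≡.trans (ℤ.pos-* (x ℕ.* y) (2 ℕ.^ m)) (≡.cong (ℤ._* pow₂ m) (ℤ.pos-* x y))

  λT≈e[2q] : ∀ β₁ β₂ → λT β₁ β₂ ≈ e (+ 2 ℤ.* q (+ toℕ β₁) (+ toℕ β₂))
  λT≈e[2q] β₁ β₂ = trans (sym (e-+ (a₁ ℤ.* + X₁) (a₂ ℤ.* + X₂))) (reflexive (≡.cong e exponent))
    where
    x₁ = toℕ β₁
    x₂ = toℕ β₂
    X₁ = x₁ ℕ.* x₁ ℕ.* 2 ℕ.^ (N ℕ.∸ (k₁ ℕ.+ 2))
    X₂ = x₂ ℕ.* x₂ ℕ.* 2 ℕ.^ (N ℕ.∸ (k₂ ℕ.+ 2))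
    collect : ∀ a₁ a₂ X₁ X₂ P₁ P₂ → a₁ ℤ.* (X₁ ℤ.* X₁ ℤ.* (+ 2 ℤ.* P₂)) ℤ.+ a₂ ℤ.* (X₂ ℤ.* X₂ ℤ.* (+ 2 ℤ.* P₁))
                                    ≡ + 2 ℤ.* (a₁ ℤ.* (X₁ ℤ.* X₁) ℤ.* P₂ ℤ.+ a₂ ℤ.* (X₂ ℤ.* X₂) ℤ.* P₁)
    collect = solve-∀
    exponent : a₁ ℤ.* + X₁ ℤ.+ a₂ ℤ.* + X₂ ≡ + 2 ℤ.* q (+ x₁) (+ x₂)
    exponent = ≡.trans
      (≡.cong₂ (λ m n → a₁ ℤ.* m ℤ.+ a₂ ℤ.* n)
        (≡.trans (pos-x*y*2ᵐ x₁ x₁ (reindex₁ 2)) (≡.cong (λ P → + x₁ ℤ.* + x₁ ℤ.* P) (pow₂-suc k₂)))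
        (≡.trans (pos-x*y*2ᵐ x₂ x₂ (reindex₂ 2)) (≡.cong (λ P → + x₂ ℤ.* + x₂ ℤ.* P) (pow₂-suc k₁))))
      (collect a₁ a₂ (+ x₁) (+ x₂) P₁ P₂)

  eBneg-pair : ∀ y₁ y₂ x₁ x₂ → eBneg k₁ a₁ y₁ x₁ * eBneg k₂ a₂ y₂ x₂ ≈ e (ℤ.- (+ 4 ℤ.* b (+ y₁) (+ y₂) (+ x₁) (+ x₂)))
  eBneg-pair y₁ y₂ x₁ x₂ = trans (sym (e-+ (ℤ.- (a₁ ℤ.* + Z₁)) (ℤ.- (a₂ ℤ.* + Z₂)))) (reflexive (≡.cong e exponent))
    where
    Z₁ = y₁ ℕ.* x₁ ℕ.* 2 ℕ.^ (N ℕ.∸ (k₁ ℕ.+ 1))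
    Z₂ = y₂ ℕ.* x₂ ℕ.* 2 ℕ.^ (N ℕ.∸ (k₂ ℕ.+ 1))
    collect : ∀ a₁ a₂ Y₁ Y₂ X₁ X₂ P₁ P₂ →
              ℤ.- (a₁ ℤ.* (Y₁ ℤ.* X₁ ℤ.* (+ 4 ℤ.* P₂))) ℤ.+ ℤ.- (a₂ ℤ.* (Y₂ ℤ.* X₂ ℤ.* (+ 4 ℤ.* P₁)))
              ≡ ℤ.- (+ 4 ℤ.* (a₁ ℤ.* (Y₁ ℤ.* X₁) ℤ.* P₂ ℤ.+ a₂ ℤ.* (Y₂ ℤ.* X₂) ℤ.* P₁))
    collect = solve-∀
    exponent : ℤ.- (a₁ ℤ.* + Z₁) ℤ.+ ℤ.- (a₂ ℤ.* + Z₂) ≡ ℤ.- (+ 4 ℤ.* b (+ y₁) (+ y₂) (+ x₁) (+ x₂))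
    exponent = ≡.trans
      (≡.cong₂ (λ m n → ℤ.- (a₁ ℤ.* m) ℤ.+ ℤ.- (a₂ ℤ.* n))
        (≡.trans (pos-x*y*2ᵐ y₁ x₁ (reindex₁ 1)) (≡.cong (λ P → + y₁ ℤ.* + x₁ ℤ.* P) (pow₂-2+ k₂)))
        (≡.trans (pos-x*y*2ᵐ y₂ x₂ (reindex₂ 1)) (≡.cong (λ P → + y₂ ℤ.* + x₂ ℤ.* P) (pow₂-2+ k₁))))
      (collect a₁ a₂ (+ y₁) (+ y₂) (+ x₁) (+ x₂) P₁ P₂)

  ρS-pair : ∀ γ₁ γ₂ β₁ β₂ → ρ k₁ a₁ S γ₁ β₁ * ρ k₂ a₂ S γ₂ β₂
            ≈ (C₁.n⁻¹ * C₁.Ḡ) * (C₂.n⁻¹ * C₂.Ḡ) * e (ℤ.- (+ 4 ℤ.* b (+ toℕ β₁) (+ toℕ β₂) (+ toℕ γ₁) (+ toℕ γ₂)))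
  ρS-pair γ₁ γ₂ β₁ β₂ = begin
    (C₁.n⁻¹ * (C₁.Ḡ * B₁)) * (C₂.n⁻¹ * (C₂.Ḡ * B₂))
      ≈⟨ prove 6 ((var 0F ⊕ (var 1F ⊕ var 2F)) ⊕ (var 3F ⊕ (var 4F ⊕ var 5F)))
                 (((var 0F ⊕ var 1F) ⊕ (var 3F ⊕ var 4F)) ⊕ (var 2F ⊕ var 5F))
                 (C₁.n⁻¹ ∷ C₁.Ḡ ∷ B₁ ∷ C₂.n⁻¹ ∷ C₂.Ḡ ∷ B₂ ∷ []) ⟩
    (C₁.n⁻¹ * C₁.Ḡ) * (C₂.n⁻¹ * C₂.Ḡ) * (B₁ * B₂)
      ≈⟨ *-congˡ (eBneg-pair (toℕ β₁) (toℕ β₂) (toℕ γ₁) (toℕ γ₂)) ⟩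
    (C₁.n⁻¹ * C₁.Ḡ) * (C₂.n⁻¹ * C₂.Ḡ) * e (ℤ.- (+ 4 ℤ.* b (+ toℕ β₁) (+ toℕ β₂) (+ toℕ γ₁) (+ toℕ γ₂))) ∎
    where
    B₁ = eBneg k₁ a₁ (toℕ β₁) (toℕ γ₁)
    B₂ = eBneg k₂ a₂ (toℕ β₂) (toℕ γ₂)

  2ᴺ≡8P₁P₂ : pow₂ N ≡ + 8 ℤ.* (P₁ ℤ.* P₂)
  2ᴺ≡8P₁P₂ = ≡.trans (pow₂-2+ (suc (k₁ ℕ.+ k₂)))
               (≡.trans (≡.cong (+ 4 ℤ.*_) (≡.trans (pow₂-suc (k₁ ℕ.+ k₂)) (≡.cong (+ 2 ℤ.*_) (pow₂-+ k₁ k₂))))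
                        (≡.sym (ℤ.*-assoc (+ 4) (+ 2) (P₁ ℤ.* P₂))))

  2ᴺ∣2q⇒4P₁P₂∣q : ∀ {x₁ x₂} → pow₂ N ∣ + 2 ℤ.* q x₁ x₂ → + 4 ℤ.* (P₁ ℤ.* P₂) ∣ q x₁ x₂
  2ᴺ∣2q⇒4P₁P₂∣q {x₁} {x₂} 2ᴺ∣2q =
    *-cancelˡ-∣ (+ 2) (≡.subst (_∣ + 2 ℤ.* q x₁ x₂) (≡.trans 2ᴺ≡8P₁P₂ (ℤ.*-assoc (+ 2) (+ 4) (P₁ ℤ.* P₂))) 2ᴺ∣2q)

  2ᴺ∣32q⇒P₁P₂∣4q : ∀ {x₁ x₂} → pow₂ N ∣ + 32 ℤ.* q x₁ x₂ → P₁ ℤ.* P₂ ∣ + 4 ℤ.* q x₁ x₂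
  2ᴺ∣32q⇒P₁P₂∣4q {x₁} {x₂} 2ᴺ∣32q = *-cancelˡ-∣ (+ 8) (≡.subst₂ _∣_ 2ᴺ≡8P₁P₂ (ℤ.*-assoc (+ 8) (+ 4) (q x₁ x₂)) 2ᴺ∣32q)

  antipode-∣ℤ : ∀ k (β : Fin (size k)) → + 2 ℤ.* pow₂ k ∣ + toℕ β ℤ.+ + toℕ (antipode β)
  antipode-∣ℤ k β = ≡.subst₂ _∣_ (pow₂-suc k) (ℤ.pos-+ (toℕ β) (toℕ (antipode β)))
                      (∣ᵤ⇒∣ {+ size k} {+ (toℕ β ℕ.+ toℕ (antipode β))} (antipode-∣ β))

  act-S-antipode : ∀ y γ₁ γ₂ → pow₂ N ∣ + 2 ℤ.* q (+ toℕ γ₁) (+ toℕ γ₂) →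
                   (∀ β₁ β₂ → ¬ (pow₂ N ∣ + 32 ℤ.* q (+ toℕ β₁) (+ toℕ β₂)) → y β₁ β₂ ≈ 0#) →
                   actGen k₁ k₂ a₁ a₂ S y γ₁ γ₂ ≈ actGen k₁ k₂ a₁ a₂ S y (antipode γ₁) (antipode γ₂)
  act-S-antipode y γ₁ γ₂ 2ᴺ∣2qγ y-support = sum-cong-≋ λ β₁ → sum-cong-≋ λ β₂ → term β₁ β₂
    where
    -γ₁ = antipode γ₁
    -γ₂ = antipode γ₂
    term : ∀ β₁ β₂ → ρ k₁ a₁ S γ₁ β₁ * (ρ k₂ a₂ S γ₂ β₂ * y β₁ β₂) ≈ ρ k₁ a₁ S -γ₁ β₁ * (ρ k₂ a₂ S -γ₂ β₂ * y β₁ β₂)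
    term β₁ β₂ with pow₂ N ∣? + 32 ℤ.* q (+ toℕ β₁) (+ toℕ β₂)
    ... | no 2ᴺ∤32qβ = trans (vanish γ₁ γ₂) (sym (vanish -γ₁ -γ₂))
      where
      vanish : ∀ δ₁ δ₂ → ρ k₁ a₁ S δ₁ β₁ * (ρ k₂ a₂ S δ₂ β₂ * y β₁ β₂) ≈ 0#
      vanish δ₁ δ₂ = trans (*-congˡ (trans (*-congˡ (y-support β₁ β₂ 2ᴺ∤32qβ)) (zeroʳ _))) (zeroʳ _)
    ... | yes 2ᴺ∣32qβ = begin
      ρ k₁ a₁ S γ₁ β₁ * (ρ k₂ a₂ S γ₂ β₂ * y β₁ β₂)     ≈⟨ *-assoc _ _ _ ⟨
      (ρ k₁ a₁ S γ₁ β₁ * ρ k₂ a₂ S γ₂ β₂) * y β₁ β₂     ≈⟨ *-congʳ (ρS-pair γ₁ γ₂ β₁ β₂) ⟩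
      K * e (ℤ.- 4bG) * y β₁ β₂                         ≈⟨ *-congʳ (*-congˡ phase) ⟩
      K * e (ℤ.- 4bH) * y β₁ β₂                         ≈⟨ *-congʳ (ρS-pair -γ₁ -γ₂ β₁ β₂) ⟨
      (ρ k₁ a₁ S -γ₁ β₁ * ρ k₂ a₂ S -γ₂ β₂) * y β₁ β₂   ≈⟨ *-assoc _ _ _ ⟩
      ρ k₁ a₁ S -γ₁ β₁ * (ρ k₂ a₂ S -γ₂ β₂ * y β₁ β₂)   ∎
      where
      K = (C₁.n⁻¹ * C₁.Ḡ) * (C₂.n⁻¹ * C₂.Ḡ)
      B₁ = + toℕ β₁
      B₂ = + toℕ β₂
      G₁ = + toℕ γ₁
      G₂ = + toℕ γ₂
      H₁ = + toℕ -γ₁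
      H₂ = + toℕ -γ₂
      4bG = + 4 ℤ.* b B₁ B₂ G₁ G₂
      4bH = + 4 ℤ.* b B₁ B₂ H₁ H₂
      8P₁P₂∣4bG-4bH : + 8 ℤ.* (P₁ ℤ.* P₂) ∣ 4bG ℤ.- 4bH
      8P₁P₂∣4bG-4bH = 4b-antipodal-invariant {w} a₁a₂≡4w+1 {B₁} {B₂} {G₁} {G₂} {H₁} {H₂}
                        (2ᴺ∣2q⇒4P₁P₂∣q {G₁} {G₂} 2ᴺ∣2qγ) (2ᴺ∣32q⇒P₁P₂∣4q {B₁} {B₂} 2ᴺ∣32qβ)
                        (antipode-∣ℤ k₁ γ₁) (antipode-∣ℤ k₂ γ₂)
      neg-minus : ∀ X Y → ℤ.- (X ℤ.- Y) ≡ ℤ.- X ℤ.- ℤ.- Y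
      neg-minus = solve-∀
      phase : e (ℤ.- 4bG) ≈ e (ℤ.- 4bH)
      phase = e-cong-mod {ℤ.- 4bG} {ℤ.- 4bH} (≡.subst₂ _∣_ (≡.sym 2ᴺ≡8P₁P₂) (neg-minus 4bG 4bH) (∣m⇒∣-m 8P₁P₂∣4bG-4bH))

  act-cong : ∀ ws {x y} → x ≋ y → act k₁ k₂ a₁ a₂ ws x ≋ act k₁ k₂ a₁ a₂ ws y
  act-cong [] x≋y = x≋y
  act-cong (g ∷ ws) x≋y = ⊗-cong (ρ k₁ a₁ g) (ρ k₂ a₂ g) (act-cong ws x≋y)

  eigenvector-support : ∀ {t x} m → t ≈ e m → ¬ (pow₂ N ∣ m) → t * x ≈ x → x ≈ 0#
  eigenvector-support m t≈eᵐ 2ᴺ∤m tx≈x = ≉1-fixed⇒≈0 (λ t≈1 → 2ᴺ∤m (e≈1⇒2ᴺ∣ (trans (sym t≈eᵐ) t≈1))) tx≈x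

  λT¹⁶≈e[32q] : ∀ β₁ β₂ → λT β₁ β₂ ^ 16 ≈ e (+ 32 ℤ.* q (+ toℕ β₁) (+ toℕ β₂))
  λT¹⁶≈e[32q] β₁ β₂ = begin
    λT β₁ β₂ ^ 16                                      ≈⟨ ^-congˡ 16 (λT≈e[2q] β₁ β₂) ⟩
    e (+ 2 ℤ.* q (+ toℕ β₁) (+ toℕ β₂)) ^ 16           ≈⟨ e-*ℕ 16 (+ 2 ℤ.* q (+ toℕ β₁) (+ toℕ β₂)) ⟨
    e (+ 16 ℤ.* (+ 2 ℤ.* q (+ toℕ β₁) (+ toℕ β₂)))     ≡⟨ ≡.cong e (ℤ.*-assoc (+ 16) (+ 2) (q (+ toℕ β₁) (+ toℕ β₂))) ⟨
    e (+ 32 ℤ.* q (+ toℕ β₁) (+ toℕ β₂))               ∎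

  -- lower-word = ST¹⁶S³ has matrix (1 0; −16 1).
  T-word S²-word lower-word : Word
  T-word = T ∷ []
  S²-word = S ∷ S ∷ []
  lower-word = S ∷ replicate 16 T ++ S ∷ S ∷ S ∷ []

  T∈Γ₀16 : InΓ₀16 T-word
  T∈Γ₀16 = divides 0 ≡.refl

  S²∈Γ₀16 : InΓ₀16 S²-word
  S²∈Γ₀16 = divides 0 ≡.refl

  lower∈Γ₀16 : InΓ₀16 lower-word
  lower∈Γ₀16 = divides 1 ≡.refl

  Γ₀16-invariant⇒≈0 : ∀ v → Γ₀16-invariant k₁ k₂ a₁ a₂ v → ∀ γ₁ γ₂ → v γ₁ γ₂ ≈ 0#
  Γ₀16-invariant⇒≈0 v inv γ₁ γ₂ with pow₂ N ∣? + 2 ℤ.* q (+ toℕ γ₁) (+ toℕ γ₂)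
  ... | no 2ᴺ∤2qγ = eigenvector-support _ (λT≈e[2q] γ₁ γ₂) 2ᴺ∤2qγ (trans (sym (act-T v γ₁ γ₂)) (inv T-word T∈Γ₀16 γ₁ γ₂))
  ... | yes 2ᴺ∣2qγ = x≈-x⇒x≈0 (begin
    v γ₁ γ₂                                   ≈⟨ S²v≋v γ₁ γ₂ ⟨
    actGen k₁ k₂ a₁ a₂ S u γ₁ γ₂              ≈⟨ act-S-antipode u γ₁ γ₂ 2ᴺ∣2qγ u-support ⟩
    actGen k₁ k₂ a₁ a₂ S u -γ₁ -γ₂            ≈⟨ act-S² v -γ₁ -γ₂ ⟩
    - v (antipode -γ₁) (antipode -γ₂)         ≡⟨ ≡.cong₂ (λ β₁ β₂ → - v β₁ β₂) (antipode-involutive γ₁) (antipode-involutive γ₂) ⟩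
    - v γ₁ γ₂                                 ∎)
    where
    -γ₁ = antipode γ₁
    -γ₂ = antipode γ₂
    u = actGen k₁ k₂ a₁ a₂ S v
    S²v≋v : act k₁ k₂ a₁ a₂ S²-word v ≋ v
    S²v≋v = inv S²-word S²∈Γ₀16
    S²u≋u : act k₁ k₂ a₁ a₂ S²-word u ≋ u
    S²u≋u = act-cong (S ∷ []) S²v≋v
    T¹⁶u≋u : act k₁ k₂ a₁ a₂ (replicate 16 T) u ≋ u
    T¹⁶u≋u = act-S²-injective λ β₁ β₂ → begin
      act k₁ k₂ a₁ a₂ (S²-word ++ replicate 16 T) u β₁ β₂              ≈⟨ act-cong (S²-word ++ replicate 16 T) S²u≋u β₁ β₂ ⟨
      act k₁ k₂ a₁ a₂ (S ∷ lower-word) v β₁ β₂                          ≈⟨ act-cong (S ∷ []) (inv lower-word lower∈Γ₀16) β₁ β₂ ⟩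
      u β₁ β₂                                                           ≈⟨ S²u≋u β₁ β₂ ⟨
      act k₁ k₂ a₁ a₂ S²-word u β₁ β₂                                   ∎
    u-support : ∀ β₁ β₂ → ¬ (pow₂ N ∣ + 32 ℤ.* q (+ toℕ β₁) (+ toℕ β₂)) → u β₁ β₂ ≈ 0#
    u-support β₁ β₂ 2ᴺ∤32qβ = eigenvector-support _ (λT¹⁶≈e[32q] β₁ β₂) 2ᴺ∤32qβ
                                (trans (sym (act-Tʲ 16 u β₁ β₂)) (T¹⁶u≋u β₁ β₂))

open import Data.Nat using (_+_; _∸_) renaming (_^_ to _^ℕ_)
open import Data.Integer using () renaming (_*_ to _*ℤ_; _-_ to _-ℤ_)
open import Data.Integer.Divisibility using (_∣_)
open Arithmetic using (Odd⇒≡2*+1; odd-product-square⇒≡1[4]; odd-product≡1[4]⇒sum≡2[4])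

lemma4p17 : ∀ {c ℓ} (F : Char0Field c ℓ) (k₁ k₂ : ℕ) (a₁ a₂ : ℤ) →
    Odd a₁ → Odd a₂ → (∃ λ x → (+ 4) ∣ (a₁ *ℤ a₂ -ℤ x *ℤ x)) →
    (ζ : Char0Field.Carrier F) →
    Char0Field._≈_ F (Char0Field._^_ F ζ (2 ^ℕ ((k₁ + k₂ + 3) ∸ 1))) (Char0Field.-_ F (Char0Field.1# F)) →
    (v : Weil.TVec F (k₁ + k₂ + 3) ζ k₁ k₂) →
    Weil.Γ₀16-invariant F (k₁ + k₂ + 3) ζ k₁ k₂ a₁ a₂ v →
    ∀ β₁ β₂ → Char0Field._≈_ F (v β₁ β₂) (Char0Field.0# F)
lemma4p17 F k₁ k₂ a₁ a₂ odd₁ odd₂ a₁a₂≡□ ζ rewrite ℕ.+-comm (k₁ + k₂) 3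
  with Odd⇒≡2*+1 {a₁} odd₁ | Odd⇒≡2*+1 {a₂} odd₂ | odd-product-square⇒≡1[4] {a₁} {a₂} odd₁ odd₂ a₁a₂≡□
... | u₁ , a₁≡2u₁+1 | u₂ , a₂≡2u₂+1 | w , a₁a₂≡4w+1
  with odd-product≡1[4]⇒sum≡2[4] {a₁} {a₂} {u₁} {u₂} {w} a₁≡2u₁+1 a₂≡2u₂+1 a₁a₂≡4w+1
... | s , a₁+a₂≡2[2s+1] = λ ζ-half →
  Invariants.Γ₀16-invariant⇒≈0 F k₁ k₂ ζ ζ-half {a₁} {a₂} {u₁} {u₂} {w} {s} a₁≡2u₁+1 a₂≡2u₂+1 a₁a₂≡4w+1 a₁+a₂≡2[2s+1]
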